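{- For every prime $p$ fix a primitive root $g(p)$ modulo $p$ (with $g(2)=1$). Then the set $$\mathfrak{P}=\{P : P \text{ is a } \Sigma\text{ -pattern with first symbol in } \Sigma,\ |P|_{?}=1,\ \mathrm{T}(P)\text{ is completely additive}\}$$ equals $$\big\{\,\big((\lambda_{p,g(p)}\cdot c)\,\rho_d\big)^{(k)} \;:\; p \text{ prime},\ k\ge 1,\ c,d\in\Sigma,\ \xi(p-1,|\Sigma|)\text{ divides } c\,\big\}\ \cup\ \{\,0^{j}\,?\,0^{l} : j\ge 1,\ l\ge 0\,\}.$$
   Context: $\Sigma=\mathbb{Z}/k\mathbb{Z}=\{0,\dots,k-1\}$ (addition mod $k$) is a fixed finite cyclic group. $\mathrm{S}_\Sigma$ is the group of bijections $\Sigma\to\Sigma$ (assumed disjoint from $\Sigma$); its elements are called gaps, $?$ denotes the identity bijection, and for $d\in\Sigma$, $\rho_d$ denotes the rotation $x\mapsto x+d$. A $\Sigma$-pattern is a nonempty finite word over $\Sigma\cup\mathrm{S}_\Sigma$; $|P|$ is its length and $|P|_?$ its number of gaps (letters in $\mathrm{S}_\Sigma$). For words (finite or infinite) $x,y$ over $\Sigma\cup \mathrm{S}_\Sigma$, $x\langle y\rangle$ fills the gaps of $x$ in order with the letters of $y$: $(a\,x)\langle y\rangle=a\,x\langle y\rangle$, $(f\,x)\langle b\,y\rangle=f(b)\,x\langle y\rangle$, $(f\,x)\langle g\,y\rangle=(f\circ g)\,x\langle y\rangle$, $x\langle\varepsilon\rangle=x$ (for $a,b\in\Sigma$, $f,g\in\mathrm{S}_\Sigma$;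 for finite words one requires the number of gaps of $x$ to equal the length of $y$). For a pattern $P$ whose first symbol lies in $\Sigma$, let $T_0=?^\omega$, $T_{i+1}=P^\omega\langle T_i\rangle$, and $\mathrm{T}(P)=\lim_i T_i$, an infinite word over $\Sigma$ indexed by positive integers (the Toeplitz word generated by $P$). With $\xi(n,m)=m/\gcd(n,m)$, the composition of patterns is $P\circ Q=P$ if $|P|_?=0$, and otherwise $P\circ Q=P^{d_1}\langle Q^{d_2}\rangle$ with $d_1=\xi(|P|_?,|Q|)$, $d_2=\xi(|Q|,|P|_?)$; powers are $P^{(0)}=?$, $P^{(n+1)}=P\circ P^{(n)}$. A sequence $\sigma:\mathbb{Z}_{>0}\to\Sigma$ is completely additive if $\sigma(1)=0$ and $\sigma(nm)=\sigma(n)+\sigma(m)$ for all $n,m\ge1$. For a word $w=w_1\dots w_r$ over $\{0,1,\dots\}$ and $c\in\Sigma$, $w\cdot c$ is the word $(w_1c)\dots(w_rc)$ where $jc=c+\dots+c$ ($j$ times); "$\xi$ divides $c$" means $c=\xi\,c'$ for some $c'\in\Sigma$. For an odd prime $p$ and primitive root $g$ mod $p$, $\lambda_{p,g}=\log_g(1)\log_g(2)\cdots\log_g(p-1)$, where $\log_g(a)\in\{0,\dots,p-2\}$ is the unique $e$ with $g^e\equiv a \pmod p$ (so the first letter is $0$); $\lambda_{2,1}=0$. Convention: whenever $\mathrm{T}(P)$ is not surjective onto $\Sigma$, a gap $f$ occurring in $P$ is identified with every bijection agreeing with $f$ on the letters occurring in $\mathrm{T}(P)$; equalities of patterns are understood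 modulo this identification. -}

module Defs where

open import Data.Nat using (ℕ; zero; suc; _+_; _*_; _∸_; _^_; _≤_; _<_; _%_; _/_)
open import Data.Nat.DivMod using (_mod_)
open import Data.Nat.GCD using (gcd)
open import Data.Nat.Primality using (Prime)
open import Data.Fin using (Fin; toℕ) renaming (zero to fzero)
open import Data.Sum using (_⊎_; inj₁; inj₂)
open import Data.Product using (_×_; ∃; ∃-syntax; _,_)
open import Data.Bool using (Bool; true; false; if_then_else_)
open import Data.List as List using (List; []; _∷_; upTo; replicate)
open import Data.List.NonEmpty as List⁺ using (List⁺; _∷_; _⁺++_; toList)
open import Data.List.Relation.Unary.All using (All)
open import Data.List.Relation.Binary.Pointwise using (Pointwise)
open import Data.Empty using (⊥)
open import Relation.Binary.PropositionalEquality using (_≡_; _≢_)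
open import Relation.Nullary.Decidable using (⌊_⌋)
open import Function using (_∘_; id)
open import Function.Definitions using (Bijective)
import Data.Nat as ℕ

-- The alphabet Σ = ℤ/Kℤ with K = suc n, represented by Fin (suc n).

Sym : ℕ → Set
Sym n = Fin (suc n)

-- Letters of patterns: elements of Σ (inj₁) or maps Σ → Σ (inj₂, gaps).
-- Bijectivity of gaps is imposed separately by IsSigmaPattern.
Letter : ℕ → Set
Letter n = Sym n ⊎ (Sym n → Sym n)

Pattern : ℕ → Set
Pattern n = List⁺ (Letter n)

module _ {n : ℕ} where

  K : ℕ
  K = suc n

  _⊕_ : Sym n → Sym n → Sym n
  a ⊕ b = (toℕ a + toℕ b) mod K

  _⊙_ : ℕ → Sym n → Sym n
  zero ⊙ c = fzero
  suc j ⊙ c = c ⊕ (j ⊙ c)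

  ρ : Sym n → (Sym n → Sym n)
  ρ d x = x ⊕ d

  gap? : Letter n
  gap? = inj₂ id

  isGap : Letter n → Bool
  isGap (inj₁ _) = false
  isGap (inj₂ _) = true

  numGapsL : List (Letter n) → ℕ
  numGapsL [] = 0
  numGapsL (x ∷ xs) = (if isGap x then 1 else 0) + numGapsL xs

  numGaps : Pattern n → ℕ
  numGaps P = numGapsL (toList P)

  GapBij : Letter n → Set
  GapBij (inj₁ _) = Data.Unit.⊤ where import Data.Unit
  GapBij (inj₂ f) = Bijective _≡_ _≡_ f

  IsSigmaPattern : Pattern n → Set
  IsSigmaPattern P = All GapBij (toList P)

  FirstInΣ : Pattern n → Set
  FirstInΣ P = ∃[ a ] (List⁺.head P ≡ inj₁ a)

  fillL : List (Letter n) → List (Letter n) → List (Letter n)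
  fillL [] ys = []
  fillL (inj₁ a ∷ xs) ys = inj₁ a ∷ fillL xs ys
  fillL (inj₂ f ∷ xs) [] = inj₂ f ∷ xs
  fillL (inj₂ f ∷ xs) (inj₁ b ∷ ys) = inj₁ (f b) ∷ fillL xs ys
  fillL (inj₂ f ∷ xs) (inj₂ g ∷ ys) = inj₂ (f ∘ g) ∷ fillL xs ys

  fill : Pattern n → List (Letter n) → Pattern n
  fill (inj₁ a ∷ xs) ys = inj₁ a ∷ fillL xs ys
  fill (inj₂ f ∷ xs) [] = inj₂ f ∷ xs
  fill (inj₂ f ∷ xs) (inj₁ b ∷ ys) = inj₁ (f b) ∷ fillL xs ys
  fill (inj₂ f ∷ xs) (inj₂ g ∷ ys) = inj₂ (f ∘ g) ∷ fillL xs ys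

  -- word power P^d (d ≥ 1; for d = 0 this returns P, never used)
  wpow : Pattern n → ℕ → Pattern n
  wpow P d = P ⁺++ List.concat (replicate (d ∸ 1) (toList P))

-- ξ(a, b) = b / gcd(a, b)   (with the value 0 when gcd(a,b) = 0)

divSafe : ℕ → ℕ → ℕ
divSafe a zero = 0
divSafe a (suc b) = a / suc b

ξ : ℕ → ℕ → ℕ
ξ a b = divSafe b (gcd a b)

module _ {n : ℕ} where

  _∘ₚ_ : Pattern n → Pattern n → Pattern n
  P ∘ₚ Q with numGaps P
  ... | zero = P
  ... | suc g = fill (wpow P (ξ (suc g) (List⁺.length Q)))
                     (toList (wpow Q (ξ (List⁺.length Q) (suc g))))

  ppow : Pattern n → ℕ → Pattern n
  ppow P zero = gap? ∷ []
  ppow P (suc k) = P ∘ₚ ppow P k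

  -- The Toeplitz word.  Positions are 1-indexed; position 0 is junk.

  posω : Pattern n → ℕ → Letter n
  posω (x ∷ xs) m = List.lookup (x ∷ xs) ((m ∸ 1) mod suc (List.length xs))

  gapsUpTo : Pattern n → ℕ → ℕ
  gapsUpTo P zero = 0
  gapsUpTo P (suc m) = gapsUpTo P m + (if isGap (posω P (suc m)) then 1 else 0)

  -- T_i at position m:  T_0 = ?^ω,  T_{i+1} = P^ω⟨T_i⟩
  stage : Pattern n → ℕ → ℕ → Letter n
  stage P zero m = gap?
  stage P (suc i) m with posω P m
  ... | inj₁ a = inj₁ a
  ... | inj₂ f with stage P i (gapsUpTo P m)
  ...   | inj₁ b = inj₁ (f b)
  ...   | inj₂ g = inj₂ (f ∘ g)

  letterOr0 : Letter n → Sym n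
  letterOr0 (inj₁ a) = a
  letterOr0 (inj₂ _) = fzero

  -- T(P) at position m: the limit value; position m is already fixed in
  -- T_m when the first symbol of P is a letter.
  T : Pattern n → ℕ → Sym n
  T P m = letterOr0 (stage P m m)

  CompletelyAdditive : (ℕ → Sym n) → Set
  CompletelyAdditive σ =
    σ 1 ≡ fzero × (∀ a b → 1 ≤ a → 1 ≤ b → σ (a * b) ≡ σ a ⊕ σ b)

  OccursIn : Pattern n → Sym n → Set
  OccursIn P a = ∃[ m ] (1 ≤ m × T P m ≡ a)

  -- equality of letters modulo the identification of gaps on a set S
  data LetterEq (S : Sym n → Set) : Letter n → Letter n → Set where
    sym≡ : ∀ {a} → LetterEq S (inj₁ a) (inj₁ a)
    gap≡ : ∀ {f g} → (∀ x → S x → f x ≡ g x) → LetterEq S (inj₂ f) (inj₂ g)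

  _≈ₚ_ : Pattern n → Pattern n → Set
  P ≈ₚ Q = Pointwise (LetterEq (OccursIn P)) (toList P) (toList Q)

IsPrimitiveRoot : ℕ → ℕ → Set
IsPrimitiveRoot zero g = ⊥
IsPrimitiveRoot (suc q) g =
  (g ^ q) % suc q ≡ 1 % suc q ×
  (∀ e → 0 < e → e < q → (g ^ e) % suc q ≢ 1 % suc q)

-- least index i < b with t i = true (b if none)
firstIdx : (ℕ → Bool) → ℕ → ℕ
firstIdx t zero = zero
firstIdx t (suc b) = if t 0 then 0 else suc (firstIdx (t ∘ suc) b)

logg : ℕ → ℕ → ℕ → ℕ
logg zero g a = 0
logg (suc q) g a = firstIdx (λ e → ⌊ (g ^ e) % suc q ℕ.≟ a % suc q ⌋) q

lam : ℕ → ℕ → List ℕ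
lam p g = List.map (λ i → logg p g (suc i)) (upTo (p ∸ 1))

module _ {n : ℕ} where

  lamPattern : ℕ → ℕ → Sym n → Sym n → Pattern n
  lamPattern p g c d with List.map (λ j → inj₁ (j ⊙ c)) (lam p g)
  ... | [] = inj₂ (ρ d) ∷ []
  ... | x ∷ xs = x ∷ (xs List.++ (inj₂ (ρ d) ∷ []))

  zeroGapZero : ℕ → ℕ → Pattern n
  zeroGapZero j l = inj₁ fzero ∷
    (replicate (j ∸ 1) (inj₁ fzero) List.++ gap? ∷ replicate l (inj₁ fzero))

  DividesΣ : ℕ → Sym n → Set
  DividesΣ x c = ∃[ c' ] (c ≡ x ⊙ c')

  InFrakP : Pattern n → Set
  InFrakP P = IsSigmaPattern P × FirstInΣ P × numGaps P ≡ 1 × CompletelyAdditive (T P)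

  InRHS : (ℕ → ℕ) → Pattern n → Set
  InRHS g P =
    (∃[ p ] ∃[ k ] ∃[ c ] ∃[ d ]
       (Prime p × 1 ≤ k × DividesΣ (ξ (p ∸ 1) (suc n)) c ×
        P ≈ₚ ppow (lamPattern p (g p) c d) k))
    ⊎ (∃[ j ] ∃[ l ] (1 ≤ j × P ≈ₚ zeroGapZero j l))

module Submission where

-- Write P = w f v with a single gap f and L = |P|.  The Toeplitz recursion
-- (T(m) is the letter of P^ω at m, or f applied to T at the index of that
-- gap) makes T(P) L-periodic off the gap positions.  For a completely
-- additive T this leaves three cases:
--   * the gap is not last: T(L·t) = T(L), so T ≡ 0 and P ≈ 0^j ? 0^l;
--   * L has two coprime factors ≥ 2: a Bézout shift gives T ≡ 0 again;
--   * L = p^(a+1): T(u) = log_g(u)·T(g) on units and T(p·j) = T(j) + T(p),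
--     so T(P) agrees with T of X = (λ_{p,g}·c) ρ_d, c = T(g), d = T(p),
--     and P ≈ X^(a+1) because X^(k) = T(X)(1) … T(X)(p^k - 1) (x ↦ x + k·d).
-- Conversely those patterns have T(P) = T(X) (or ≡ 0), completely additive
-- as soon as (p-1)·c = 0, i.e. ξ(p-1, |Σ|) ∣ c.

open import Defs
open import Data.Nat using (ℕ; zero; suc; _+_; _*_; _∸_; _^_; _≤_; _<_; _%_; _/_; z≤n; s≤s; NonZero; >-nonZero; ≢-nonZero; nonTrivial⇒n>1)
open import Data.Nat.Properties
open import Data.Nat.DivMod
open import Data.Nat.Divisibility using (_∣_; divides; _∣?_; ∣-refl; ∣-trans; ∣⇒≤; ∣1⇒≡1; m∣m*n; n∣m*n; *-monoʳ-∣; *-cancelˡ-∣; ∣m+n∣m⇒∣n; m%n≡0⇒n∣m; n∣m⇒m%n≡0)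
open import Data.Nat.GCD using (gcd; module Bézout; gcd[m,n]∣m; gcd[m,n]∣n; gcd[m,n]≢0; gcd-zeroˡ; gcd-zeroʳ)
open import Data.Nat.Coprimality using (Coprime; coprime-Bézout; coprime-divisor; coprime-/gcd)
import Data.Nat.Coprimality as Coprime
open import Data.Nat.Primality using (Prime; euclidsLemma; prime⇒nonTrivial; prime⇒irreducible)
open import Data.Nat.Primality.Factorisation using (factorise)
open import Data.Nat.ListAction using (product)
open import Data.Nat.Tactic.RingSolver using (solve-∀)
open import Data.Fin as Fin using (Fin; toℕ; fromℕ<; punchOut) renaming (zero to fzero)
open import Data.Fin.Properties using (toℕ-injective; toℕ-fromℕ<; toℕ<n; any?; pigeonhole; punchOut-injective)
open import Data.Bool using (true; false; if_then_else_)
open import Data.Empty using (⊥-elim)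
open import Data.Product using (_×_; ∃; ∃-syntax; _,_; proj₁; proj₂)
open import Data.Sum using (_⊎_; inj₁; inj₂)
open import Data.List as List using (List; []; _∷_; _++_; replicate)
open import Data.List.Properties using (++-assoc; ++-identityʳ; length-++; take-all; map-++; concat-++)
open import Data.List.NonEmpty as List⁺ using (_∷_; toList)
open import Data.List.Relation.Unary.All using (_∷_)
open import Data.List.Relation.Binary.Pointwise as Pointwise using (Pointwise; []; _∷_)
open import Data.Nat.Induction using (<-rec)
open import Function using (_∘_; id)
open import Function.Bundles using (_⇔_; mk⇔)
open import Relation.Binary.Definitions using (tri<; tri≈; tri>)
open import Relation.Binary.PropositionalEquality
open import Relation.Nullary using (¬_; yes; no)
open import Relation.Nullary.Decidable using (⌊_⌋; dec-true; isYes≗does)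

%-absorbˡ : ∀ x y m .{{_ : NonZero m}} → (x % m + y) % m ≡ (x + y) % m
%-absorbˡ x y m = begin
  (x % m + y) % m           ≡⟨ %-distribˡ-+ (x % m) y m ⟩
  (x % m % m + y % m) % m   ≡⟨ cong (λ z → (z + y % m) % m) (m%n%n≡m%n x m) ⟩
  (x % m + y % m) % m       ≡⟨ %-distribˡ-+ x y m ⟨
  (x + y) % m               ∎
  where open ≡-Reasoning

%-absorbʳ : ∀ x y m .{{_ : NonZero m}} → (x + y % m) % m ≡ (x + y) % m
%-absorbʳ x y m = begin
  (x + y % m) % m  ≡⟨ cong (_% m) (+-comm x (y % m)) ⟩
  (y % m + x) % m  ≡⟨ %-absorbˡ y x m ⟩
  (y + x) % m      ≡⟨ cong (_% m) (+-comm y x) ⟩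
  (x + y) % m      ∎
  where open ≡-Reasoning

module _ {n : ℕ} where

  private
    K′ : ℕ
    K′ = suc n

  toℕ-⊕ : (a b : Sym n) → toℕ (a ⊕ b) ≡ (toℕ a + toℕ b) % K′
  toℕ-⊕ a b = toℕ-fromℕ< (m%n<n (toℕ a + toℕ b) K′)

  toℕ%K : (a : Sym n) → toℕ a % K′ ≡ toℕ a
  toℕ%K a = m<n⇒m%n≡m (toℕ<n a)

  ⊕-comm : (a b : Sym n) → a ⊕ b ≡ b ⊕ a
  ⊕-comm a b = cong (_mod K′) (+-comm (toℕ a) (toℕ b))

  ⊕-assoc : (a b c : Sym n) → (a ⊕ b) ⊕ c ≡ a ⊕ (b ⊕ c)
  ⊕-assoc a b c = toℕ-injective (begin
    toℕ ((a ⊕ b) ⊕ c)                ≡⟨ toℕ-⊕ (a ⊕ b) c ⟩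
    (toℕ (a ⊕ b) + toℕ c) % K′       ≡⟨ cong (λ z → (z + toℕ c) % K′) (toℕ-⊕ a b) ⟩
    ((toℕ a + toℕ b) % K′ + toℕ c) % K′ ≡⟨ %-absorbˡ (toℕ a + toℕ b) (toℕ c) K′ ⟩
    (toℕ a + toℕ b + toℕ c) % K′     ≡⟨ cong (_% K′) (+-assoc (toℕ a) (toℕ b) (toℕ c)) ⟩
    (toℕ a + (toℕ b + toℕ c)) % K′   ≡⟨ %-absorbʳ (toℕ a) (toℕ b + toℕ c) K′ ⟨
    (toℕ a + (toℕ b + toℕ c) % K′) % K′ ≡⟨ cong (λ z → (toℕ a + z) % K′) (toℕ-⊕ b c) ⟨
    (toℕ a + toℕ (b ⊕ c)) % K′       ≡⟨ toℕ-⊕ a (b ⊕ c) ⟨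
    toℕ (a ⊕ (b ⊕ c))                ∎)
    where open ≡-Reasoning

  ⊕-identityˡ : (a : Sym n) → fzero ⊕ a ≡ a
  ⊕-identityˡ a = toℕ-injective (trans (toℕ-⊕ fzero a) (toℕ%K a))

  ⊕-identityʳ : (a : Sym n) → a ⊕ fzero ≡ a
  ⊕-identityʳ a = trans (⊕-comm a fzero) (⊕-identityˡ a)

  ⊕-swapʳ : (x y z : Sym n) → (x ⊕ y) ⊕ z ≡ (x ⊕ z) ⊕ y
  ⊕-swapʳ x y z = trans (⊕-assoc x y z) (trans (cong (x ⊕_) (⊕-comm y z)) (sym (⊕-assoc x z y)))

  ⊖_ : Sym n → Sym n
  ⊖ a = (K′ ∸ toℕ a) mod K′

  ⊖-inverseˡ : (a : Sym n) → (⊖ a) ⊕ a ≡ fzero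
  ⊖-inverseˡ a = toℕ-injective (begin
    toℕ ((⊖ a) ⊕ a)                      ≡⟨ toℕ-⊕ (⊖ a) a ⟩
    (toℕ (⊖ a) + toℕ a) % K′             ≡⟨ cong (λ z → (z + toℕ a) % K′) (toℕ-fromℕ< (m%n<n (K′ ∸ toℕ a) K′)) ⟩
    ((K′ ∸ toℕ a) % K′ + toℕ a) % K′     ≡⟨ %-absorbˡ (K′ ∸ toℕ a) (toℕ a) K′ ⟩
    (K′ ∸ toℕ a + toℕ a) % K′            ≡⟨ cong (_% K′) (m∸n+n≡m (<⇒≤ (toℕ<n a))) ⟩
    K′ % K′                              ≡⟨ n%n≡0 K′ ⟩
    0                                    ∎)
    where open ≡-Reasoning

  ⊕-cancelˡ : (a x y : Sym n) → a ⊕ x ≡ a ⊕ y → x ≡ y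
  ⊕-cancelˡ a x y e = begin
    x                  ≡⟨ ⊕-identityˡ x ⟨
    fzero ⊕ x          ≡⟨ cong (_⊕ x) (⊖-inverseˡ a) ⟨
    ((⊖ a) ⊕ a) ⊕ x    ≡⟨ ⊕-assoc (⊖ a) a x ⟩
    (⊖ a) ⊕ (a ⊕ x)    ≡⟨ cong ((⊖ a) ⊕_) e ⟩
    (⊖ a) ⊕ (a ⊕ y)    ≡⟨ ⊕-assoc (⊖ a) a y ⟨
    ((⊖ a) ⊕ a) ⊕ y    ≡⟨ cong (_⊕ y) (⊖-inverseˡ a) ⟩
    fzero ⊕ y          ≡⟨ ⊕-identityˡ y ⟩
    y                  ∎
    where open ≡-Reasoning

  ⊕-fixed⇒0 : (a x : Sym n) → a ⊕ x ≡ a → x ≡ fzero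
  ⊕-fixed⇒0 a x e = ⊕-cancelˡ a x fzero (trans e (sym (⊕-identityʳ a)))

  ⊙-distrib-+ : ∀ i j (c : Sym n) → (i + j) ⊙ c ≡ (i ⊙ c) ⊕ (j ⊙ c)
  ⊙-distrib-+ zero    j c = sym (⊕-identityˡ (j ⊙ c))
  ⊙-distrib-+ (suc i) j c = trans (cong (c ⊕_) (⊙-distrib-+ i j c)) (sym (⊕-assoc c (i ⊙ c) (j ⊙ c)))

  ⊙-assoc : ∀ i j (c : Sym n) → (i * j) ⊙ c ≡ i ⊙ (j ⊙ c)
  ⊙-assoc zero    j c = refl
  ⊙-assoc (suc i) j c = trans (⊙-distrib-+ j (i * j) c) (cong ((j ⊙ c) ⊕_) (⊙-assoc i j c))

  ⊙-zero : ∀ i → i ⊙ fzero ≡ fzero {n}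
  ⊙-zero zero    = refl
  ⊙-zero (suc i) = trans (cong (fzero ⊕_) (⊙-zero i)) (⊕-identityˡ fzero)

  -- (suc j) ⊙ d = (j ⊙ d) ⊕ d : the form in which iterated rotations compose
  ⊙-suc : ∀ j (d : Sym n) → suc j ⊙ d ≡ (j ⊙ d) ⊕ d
  ⊙-suc j d = ⊕-comm d (j ⊙ d)

  toℕ-⊙ : ∀ j (c : Sym n) → toℕ (j ⊙ c) ≡ (j * toℕ c) % K′
  toℕ-⊙ zero    c = refl
  toℕ-⊙ (suc j) c = begin
    toℕ (c ⊕ (j ⊙ c))                ≡⟨ toℕ-⊕ c (j ⊙ c) ⟩
    (toℕ c + toℕ (j ⊙ c)) % K′       ≡⟨ cong (λ x → (toℕ c + x) % K′) (toℕ-⊙ j c) ⟩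
    (toℕ c + (j * toℕ c) % K′) % K′  ≡⟨ %-absorbʳ (toℕ c) (j * toℕ c) K′ ⟩
    (toℕ c + j * toℕ c) % K′         ∎
    where open ≡-Reasoning

  K⊙≡0 : ∀ (x : Sym n) → K′ ⊙ x ≡ fzero
  K⊙≡0 x = toℕ-injective (trans (toℕ-⊙ K′ x) (trans (cong (_% K′) (*-comm K′ (toℕ x))) (m*n%n≡0 (toℕ x) K′)))

  ⊙-mod : ∀ m i (c : Sym n) .{{_ : NonZero m}} → m ⊙ c ≡ fzero → i ⊙ c ≡ (i % m) ⊙ c
  ⊙-mod m i c mc = begin
    i ⊙ c                                ≡⟨ cong (_⊙ c) (m≡m%n+[m/n]*n i m) ⟩
    (i % m + (i / m) * m) ⊙ c            ≡⟨ ⊙-distrib-+ (i % m) ((i / m) * m) c ⟩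
    ((i % m) ⊙ c) ⊕ (((i / m) * m) ⊙ c)  ≡⟨ cong (((i % m) ⊙ c) ⊕_) multiple ⟩
    ((i % m) ⊙ c) ⊕ fzero                ≡⟨ ⊕-identityʳ _ ⟩
    (i % m) ⊙ c                          ∎
    where
    open ≡-Reasoning
    multiple : ((i / m) * m) ⊙ c ≡ fzero
    multiple = trans (⊙-assoc (i / m) m c) (trans (cong ((i / m) ⊙_) mc) (⊙-zero (i / m)))

-- Reading words.  letterAt is a total lookup (junk past the end) and
-- positions of P^ω are read off P itself modulo its length.
module _ {n : ℕ} where

  letterAt : List (Letter n) → ℕ → Letter n
  letterAt []       i       = inj₁ fzero
  letterAt (x ∷ xs) zero    = x
  letterAt (x ∷ xs) (suc i) = letterAt xs i

  lookup≡letterAt : ∀ (xs : List (Letter n)) (i : Fin (List.length xs)) → List.lookup xs i ≡ letterAt xs (toℕ i)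
  lookup≡letterAt (x ∷ xs) fzero     = refl
  lookup≡letterAt (x ∷ xs) (Fin.suc i) = lookup≡letterAt xs i

  len : Pattern n → ℕ
  len = List⁺.length

  len≡length : ∀ (P : Pattern n) → len P ≡ List.length (toList P)
  len≡length (x ∷ xs) = refl

  posω≡letterAt : ∀ P m → posω P m ≡ letterAt (toList P) ((m ∸ 1) % len P)
  posω≡letterAt (x ∷ xs) m =
    trans (lookup≡letterAt (x ∷ xs) ((m ∸ 1) mod suc (List.length xs)))
          (cong (letterAt (x ∷ xs)) (toℕ-fromℕ< (m%n<n (m ∸ 1) (suc (List.length xs)))))

  letterAt-++ˡ : ∀ (ws ys : List (Letter n)) i → i < List.length ws → letterAt (ws ++ ys) i ≡ letterAt ws i
  letterAt-++ˡ (x ∷ ws) ys zero    _         = refl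
  letterAt-++ˡ (x ∷ ws) ys (suc i) (s≤s i<) = letterAt-++ˡ ws ys i i<

  letterAt-++ʳ : ∀ (ws ys : List (Letter n)) j → letterAt (ws ++ ys) (List.length ws + j) ≡ letterAt ys j
  letterAt-++ʳ []       ys j = refl
  letterAt-++ʳ (x ∷ ws) ys j = letterAt-++ʳ ws ys j

  letterAt-gapFree : ∀ (ws : List (Letter n)) i → numGapsL ws ≡ 0 → letterAt ws i ≡ inj₁ (letterOr0 (letterAt ws i))
  letterAt-gapFree []            i       _ = refl
  letterAt-gapFree (inj₁ a ∷ ws) zero    _ = refl
  letterAt-gapFree (inj₁ a ∷ ws) (suc i) e = letterAt-gapFree ws i e

  gapCount : Letter n → ℕ
  gapCount x = if isGap {n} x then 1 else 0

  gapCount≤1 : ∀ x → gapCount x ≤ 1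
  gapCount≤1 (inj₁ _) = z≤n
  gapCount≤1 (inj₂ _) = s≤s z≤n

  numGapsL-++ : ∀ (xs ys : List (Letter n)) → numGapsL (xs ++ ys) ≡ numGapsL xs + numGapsL ys
  numGapsL-++ []       ys = refl
  numGapsL-++ (x ∷ xs) ys = trans (cong (gapCount x +_) (numGapsL-++ xs ys)) (sym (+-assoc (gapCount x) _ _))

  numGapsL-take-suc : ∀ (xs : List (Letter n)) i → i < List.length xs →
                      numGapsL (List.take (suc i) xs) ≡ numGapsL (List.take i xs) + gapCount (letterAt xs i)
  numGapsL-take-suc (x ∷ xs) zero    _        = +-comm (gapCount x) 0
  numGapsL-take-suc (x ∷ xs) (suc i) (s≤s i<) =
    trans (cong (gapCount x +_) (numGapsL-take-suc xs i i<)) (sym (+-assoc (gapCount x) _ _))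

  gapsUpTo-period : ∀ (P : Pattern n) q i → i ≤ len P →
                    gapsUpTo P (q * len P + i) ≡ q * numGaps P + numGapsL (List.take i (toList P))
  gapsUpTo-period P zero    zero _ = refl
  gapsUpTo-period P (suc q) zero _ = begin
    gapsUpTo P (suc q * len P + 0)                        ≡⟨ cong (gapsUpTo P) (trans (+-identityʳ _) (+-comm (len P) (q * len P))) ⟩
    gapsUpTo P (q * len P + len P)                        ≡⟨ gapsUpTo-period P q (len P) ≤-refl ⟩
    q * numGaps P + numGapsL (List.take (len P) (toList P)) ≡⟨ cong (λ z → q * numGaps P + numGapsL z) (take-all (len P) (toList P) (≤-reflexive (sym (len≡length P)))) ⟩
    q * numGaps P + numGaps P                             ≡⟨ +-comm (q * numGaps P) _ ⟩
    suc q * numGaps P                                     ≡⟨ +-identityʳ _ ⟨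
    suc q * numGaps P + 0                                 ∎
    where open ≡-Reasoning
  gapsUpTo-period P q (suc i) i<L = begin
    gapsUpTo P (q * len P + suc i)
      ≡⟨ cong (gapsUpTo P) (+-suc (q * len P) i) ⟩
    gapsUpTo P (q * len P + i) + gapCount (posω P (suc (q * len P + i)))
      ≡⟨ cong₂ _+_ (gapsUpTo-period P q i (<⇒≤ i<L)) (cong gapCount (posω≡letterAt P (suc (q * len P + i)))) ⟩
    q * numGaps P + numGapsL (List.take i xs) + gapCount (letterAt xs ((q * len P + i) % len P))
      ≡⟨ cong (λ z → q * numGaps P + numGapsL (List.take i xs) + gapCount (letterAt xs z)) residue ⟩
    q * numGaps P + numGapsL (List.take i xs) + gapCount (letterAt xs i)
      ≡⟨ +-assoc (q * numGaps P) _ _ ⟩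
    q * numGaps P + (numGapsL (List.take i xs) + gapCount (letterAt xs i))
      ≡⟨ cong (q * numGaps P +_) (numGapsL-take-suc xs i (≤-trans i<L (≤-reflexive (len≡length P)))) ⟨
    q * numGaps P + numGapsL (List.take (suc i) xs)
      ∎
    where
    open ≡-Reasoning
    xs : List (Letter n)
    xs = toList P
    residue : (q * len P + i) % len P ≡ i
    residue = trans (cong (_% len P) (+-comm (q * len P) i)) (trans ([m+kn]%n≡m%n i q (len P)) (m<n⇒m%n≡m i<L))

module _ {n : ℕ} where

  fillLetter : Letter n → Letter n → Letter n
  fillLetter (inj₁ a) _        = inj₁ a
  fillLetter (inj₂ f) (inj₁ b) = inj₁ (f b)
  fillLetter (inj₂ f) (inj₂ g) = inj₂ (f ∘ g)

  stage-suc : ∀ P i m → stage P (suc i) m ≡ fillLetter (posω P m) (stage P i (gapsUpTo P m))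
  stage-suc P i m with posω P m
  ... | inj₁ a = refl
  ... | inj₂ f with stage P i (gapsUpTo P m)
  ...   | inj₁ b = refl
  ...   | inj₂ g = refl

  -- When the first symbol of P is a letter, the gap index of position m+1
  -- is at most m, so position m is a letter from stage m on and never
  -- changes afterwards.
  module Toeplitz (P : Pattern n) (first : FirstInΣ P) where

    gapsUpTo-bound : ∀ m → gapsUpTo P (suc m) ≤ m
    gapsUpTo-bound zero    rewrite proj₂ first = z≤n
    gapsUpTo-bound (suc m) =
      ≤-trans (+-monoˡ-≤ (gapCount (posω P (suc (suc m)))) (gapsUpTo-bound m))
              (≤-trans (+-monoʳ-≤ m (gapCount≤1 (posω P (suc (suc m))))) (≤-reflexive (+-comm m 1)))

    gapsUpTo-atGap : ∀ m f → posω P (suc m) ≡ inj₂ f → 1 ≤ gapsUpTo P (suc m)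
    gapsUpTo-atGap m f e rewrite e = ≤-trans (s≤s z≤n) (m≤n+m 1 (gapsUpTo P m))

    stage-stable : ∀ i j m → 1 ≤ m → m ≤ i → m ≤ j → stage P i m ≡ stage P j m
    stage-stable (suc i) (suc j) (suc m) _ (s≤s m≤i) (s≤s m≤j) =
      trans (stage-suc P i (suc m)) (trans (fill-agree (posω P (suc m)) refl) (sym (stage-suc P j (suc m))))
      where
      fill-agree : ∀ x → posω P (suc m) ≡ x →
                   fillLetter x (stage P i (gapsUpTo P (suc m))) ≡ fillLetter x (stage P j (gapsUpTo P (suc m)))
      fill-agree (inj₁ a) _ = refl
      fill-agree (inj₂ f) e = cong (fillLetter (inj₂ f))
        (stage-stable i j (gapsUpTo P (suc m)) (gapsUpTo-atGap m f e)
                      (≤-trans (gapsUpTo-bound m) m≤i) (≤-trans (gapsUpTo-bound m) m≤j))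

    stage-isLetter : ∀ i m → 1 ≤ m → m ≤ i → ∃[ a ] (stage P i m ≡ inj₁ a)
    stage-isLetter (suc i) (suc m) _ (s≤s m≤i) = by-letter (posω P (suc m)) refl
      where
      by-letter : ∀ x → posω P (suc m) ≡ x → ∃[ a ] (stage P (suc i) (suc m) ≡ inj₁ a)
      by-letter (inj₁ a) e = a , trans (stage-suc P i (suc m)) (cong (λ y → fillLetter y (stage P i (gapsUpTo P (suc m)))) e)
      by-letter (inj₂ f) e with stage-isLetter i (gapsUpTo P (suc m)) (gapsUpTo-atGap m f e) (≤-trans (gapsUpTo-bound m) m≤i)
      ... | b , eb = f b , trans (stage-suc P i (suc m)) (cong₂ fillLetter e eb)

    stage≡T : ∀ m → 1 ≤ m → stage P m m ≡ inj₁ (T P m)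
    stage≡T m 1≤m with stage-isLetter m m 1≤m ≤-refl
    ... | a , ea rewrite ea = refl

    T-letter : ∀ m a → 1 ≤ m → posω P m ≡ inj₁ a → T P m ≡ a
    T-letter (suc m) a _ e =
      cong letterOr0 (trans (stage-suc P m (suc m)) (cong (λ y → fillLetter y (stage P m (gapsUpTo P (suc m)))) e))

    T-gap : ∀ m f → 1 ≤ m → posω P m ≡ inj₂ f → T P m ≡ f (T P (gapsUpTo P m))
    T-gap (suc m) f _ e = cong letterOr0 (trans (stage-suc P m (suc m)) (cong₂ fillLetter e earlier))
      where
      G : ℕ
      G = gapsUpTo P (suc m)
      earlier : stage P m G ≡ inj₁ (T P G)
      earlier = trans (stage-stable m G G (gapsUpTo-atGap m f e) (gapsUpTo-bound m) ≤-refl)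
                      (stage≡T G (gapsUpTo-atGap m f e))

module OneGap {n : ℕ} (P : Pattern n) (first : FirstInΣ P) (ws : List (Letter n)) (f : Sym n → Sym n)
              (vs : List (Letter n)) (shape : toList P ≡ ws ++ inj₂ f ∷ vs)
              (ws-gapFree : numGapsL ws ≡ 0) (vs-gapFree : numGapsL vs ≡ 0) where
  open Toeplitz P first

  xs : List (Letter n)
  xs = toList P

  gapIdx tailLen period : ℕ
  gapIdx  = List.length ws
  tailLen = List.length vs
  period  = len P

  period≡ : period ≡ gapIdx + suc tailLen
  period≡ = trans (len≡length P) (trans (cong List.length shape) (length-++ ws))

  gapIdx<period : gapIdx < period
  gapIdx<period = ≤-trans (s≤s (m≤m+n gapIdx tailLen)) (≤-reflexive (trans (sym (+-suc gapIdx tailLen)) (sym period≡)))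

  numGaps≡1 : numGaps P ≡ 1
  numGaps≡1 = trans (cong numGapsL shape)
                (trans (numGapsL-++ ws (inj₂ f ∷ vs)) (cong₂ (λ a b → a + suc b) ws-gapFree vs-gapFree))

  letterAt-gapIdx : letterAt xs gapIdx ≡ inj₂ f
  letterAt-gapIdx = trans (cong (λ z → letterAt z gapIdx) shape)
    (trans (cong (letterAt (ws ++ inj₂ f ∷ vs)) (sym (+-identityʳ gapIdx))) (letterAt-++ʳ ws (inj₂ f ∷ vs) 0))

  letterAt-offGap : ∀ i → i ≢ gapIdx → letterAt xs i ≡ inj₁ (letterOr0 (letterAt xs i))
  letterAt-offGap i i≢ rewrite shape with <-cmp i gapIdx
  ... | tri< i< _ _ rewrite letterAt-++ˡ ws (inj₂ f ∷ vs) i i< = letterAt-gapFree ws i ws-gapFree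
  ... | tri≈ _ i≡ _ = ⊥-elim (i≢ i≡)
  ... | tri> _ _ i> with m≤n⇒∃[o]m+o≡n i>
  ...   | j , e rewrite sym e =
          trans inTail (trans (letterAt-gapFree vs j vs-gapFree) (cong (λ z → inj₁ (letterOr0 z)) (sym inTail)))
    where
    inTail : letterAt (ws ++ inj₂ f ∷ vs) (suc gapIdx + j) ≡ letterAt vs j
    inTail = trans (cong (letterAt (ws ++ inj₂ f ∷ vs)) (sym (+-suc gapIdx j))) (letterAt-++ʳ ws (inj₂ f ∷ vs) (suc j))

  numGaps-throughGap : numGapsL (List.take (suc gapIdx) xs) ≡ 1
  numGaps-throughGap = trans (cong (λ z → numGapsL (List.take (suc gapIdx) z)) shape) (count ws ws-gapFree)
    where
    count : ∀ (w : List (Letter n)) → numGapsL w ≡ 0 → numGapsL (List.take (suc (List.length w)) (w ++ inj₂ f ∷ vs)) ≡ 1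
    count []           _ = refl
    count (inj₁ a ∷ w) e = count w e

  gapsUpTo-atGap-q : ∀ q → gapsUpTo P (q * period + suc gapIdx) ≡ suc q
  gapsUpTo-atGap-q q = trans (gapsUpTo-period P q (suc gapIdx) gapIdx<period)
    (trans (cong₂ _+_ (cong (q *_) numGaps≡1) numGaps-throughGap) (trans (cong (_+ 1) (*-identityʳ q)) (+-comm q 1)))

  posω-atGap : ∀ q → posω P (q * period + suc gapIdx) ≡ inj₂ f
  posω-atGap q = trans (posω≡letterAt P (q * period + suc gapIdx))
    (trans (cong (λ z → letterAt xs ((z ∸ 1) % period)) (+-suc (q * period) gapIdx))
    (trans (cong (letterAt xs) residue) letterAt-gapIdx))
    where
    residue : (q * period + gapIdx) % period ≡ gapIdx
    residue = trans (cong (_% period) (+-comm (q * period) gapIdx))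
                    (trans ([m+kn]%n≡m%n gapIdx q period) (m<n⇒m%n≡m gapIdx<period))

  T-atGap : ∀ q → T P (q * period + suc gapIdx) ≡ f (T P (suc q))
  T-atGap q = trans (T-gap (q * period + suc gapIdx) f (≤-trans (s≤s z≤n) (m≤n+m (suc gapIdx) (q * period))) (posω-atGap q))
                    (cong (f ∘ T P) (gapsUpTo-atGap-q q))

  T-offGap : ∀ m → 1 ≤ m → (m ∸ 1) % period ≢ gapIdx → T P m ≡ letterOr0 (letterAt xs ((m ∸ 1) % period))
  T-offGap m 1≤m ne = T-letter m _ 1≤m (trans (posω≡letterAt P m) (letterAt-offGap _ ne))

  T-periodic : ∀ m q → 1 ≤ m → (m ∸ 1) % period ≢ gapIdx → T P (m + q * period) ≡ T P m
  T-periodic (suc m) q _ ne =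
    trans (T-offGap (suc m + q * period) (s≤s z≤n) ne′)
          (trans (cong (λ z → letterOr0 (letterAt xs z)) same-residue) (sym (T-offGap (suc m) (s≤s z≤n) ne)))
    where
    same-residue : (m + q * period) % period ≡ m % period
    same-residue = [m+kn]%n≡m%n m q period
    ne′ : (m + q * period) % period ≢ gapIdx
    ne′ x = ne (trans (sym same-residue) x)

positive-factor : ∀ {m} j p → 1 ≤ m → m ≡ j * p → 1 ≤ j
positive-factor zero    p 1≤m e = ⊥-elim (<⇒≱ 1≤m (≤-reflexive e))
positive-factor (suc _) p _   _ = s≤s z≤n

proper-cofactor : ∀ {p m} → 2 ≤ p → 1 ≤ m → p ∣ m → ∃[ j ] (m ≡ p * j × 1 ≤ j × j < m)
proper-cofactor {p} {m} 2≤p 1≤m (divides j m≡jp) = j , trans m≡jp (*-comm j p) , 1≤j , j<m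
  where
  1≤j : 1 ≤ j
  1≤j = positive-factor j p 1≤m m≡jp
  j<m : j < m
  j<m = subst (j <_) (sym m≡jp) (m<m*n j p {{>-nonZero 1≤j}} 2≤p)

last-in-block⇒∣ : ∀ p .{{_ : NonZero p}} m → (m ∸ 1) % p ≡ p ∸ 1 → 1 ≤ m → p ∣ m
last-in-block⇒∣ p (suc m) e _ = m%n≡0⇒n∣m (suc m) p (begin
  suc m % p                          ≡⟨ cong (λ z → suc z % p) (m≡m%n+[m/n]*n m p) ⟩
  suc (m % p + (m / p) * p) % p      ≡⟨ cong (λ z → suc (z + (m / p) * p) % p) e ⟩
  suc (p ∸ 1 + (m / p) * p) % p      ≡⟨ cong (_% p) (rearrange p (m / p)) ⟩
  (suc (m / p) * p) % p              ≡⟨ m*n%n≡0 (suc (m / p)) p ⟩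
  0                                  ∎)
  where
  open ≡-Reasoning
  rearrange : ∀ p k .{{_ : NonZero p}} → suc (p ∸ 1 + k * p) ≡ suc k * p
  rearrange (suc p′) k = refl

-- Bézout in the form needed to move a residue: for coprime B, A (A ≥ 2)
-- every x ≥ 1 can be shifted by a multiple of B into the class 1 mod A.
bezout-shift : ∀ A B → 2 ≤ A → Coprime B A → ∀ x → 1 ≤ x → ∃[ j ] ∃[ k ] (x + B * j ≡ 1 + k * A)
bezout-shift (suc A′) B _ cop x 1≤x with coprime-Bézout cop
... | Bézout.+- u v eq = u * (A′ * x + 1) , x + v * (A′ * x + 1) , (begin
  x + B * (u * (A′ * x + 1))           ≡⟨ step₁ x B u (A′ * x + 1) ⟩
  x + (u * B) * (A′ * x + 1)           ≡⟨ cong (λ z → x + z * (A′ * x + 1)) (sym eq) ⟩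
  x + (1 + v * suc A′) * (A′ * x + 1)  ≡⟨ step₂ x A′ v ⟩
  1 + (x + v * (A′ * x + 1)) * suc A′  ∎)
  where
  open ≡-Reasoning
  step₁ : ∀ x B u w → x + B * (u * w) ≡ x + (u * B) * w
  step₁ = solve-∀
  step₂ : ∀ x A′ v → x + (1 + v * suc A′) * (A′ * x + 1) ≡ 1 + (x + v * (A′ * x + 1)) * suc A′
  step₂ = solve-∀
bezout-shift (suc A′) B _ cop (suc x′) _ | Bézout.-+ u v eq = u * x′ , v * x′ , (begin
  suc x′ + B * (u * x′)   ≡⟨ step₁ x′ B u ⟩
  1 + (1 + u * B) * x′    ≡⟨ cong (λ z → 1 + z * x′) eq ⟩
  1 + (v * suc A′) * x′   ≡⟨ step₂ v (suc A′) x′ ⟩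
  1 + v * x′ * suc A′     ∎)
  where
  open ≡-Reasoning
  step₁ : ∀ x′ B u → suc x′ + B * (u * x′) ≡ 1 + (1 + u * B) * x′
  step₁ = solve-∀
  step₂ : ∀ v A x′ → 1 + (v * A) * x′ ≡ 1 + v * x′ * A
  step₂ = solve-∀

2≤^ : ∀ {p} k → 2 ≤ p → 1 ≤ k → 2 ≤ p ^ k
2≤^ {p} (suc k) 2≤p _ = ≤-trans 2≤p (m≤m*n p (p ^ k) {{>-nonZero (m^n>0 p {{>-nonZero (≤-trans (s≤s z≤n) 2≤p)}} k)}})

prime≥2 : ∀ {p} → Prime p → 2 ≤ p
prime≥2 {p} pr = nonTrivial⇒n>1 p {{prime⇒nonTrivial pr}}

prime-divisor : ∀ L → 2 ≤ L → ∃[ p ] (Prime p × p ∣ L)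
prime-divisor L@(suc _) 2≤L with factorise L
... | record { factors = [] ; isFactorisation = e } = ⊥-elim (<⇒≢ 2≤L (sym e))
... | record { factors = p ∷ ps ; isFactorisation = e ; factorsPrime = pr ∷ _ } =
  p , pr , divides (product ps) (trans e (*-comm p (product ps)))

prime⇒coprime-nonmultiple : ∀ {p M} → Prime p → ¬ p ∣ M → Coprime p M
prime⇒coprime-nonmultiple pr p∤M (d∣p , d∣M) with prime⇒irreducible pr d∣p
... | inj₁ d≡1 = d≡1
... | inj₂ refl = ⊥-elim (p∤M d∣M)

coprime-*ˡ : ∀ {x y z} → Coprime x z → Coprime y z → Coprime (x * y) z
coprime-*ˡ {x} cxz cyz {d} (d∣xy , d∣z) = cyz (coprime-divisor d⊥x d∣xy , d∣z)
  where
  d⊥x : Coprime d x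
  d⊥x (e∣d , e∣x) = cxz (e∣x , ∣-trans e∣d d∣z)

coprime-∣-* : ∀ {A B x} → Coprime A B → A ∣ x → B ∣ x → A * B ∣ x
coprime-∣-* {A} {B} A⊥B (divides y x≡yA) B∣x
  with coprime-divisor {o = y} (Coprime.sym A⊥B) (subst (B ∣_) (trans x≡yA (*-comm y A)) B∣x)
... | divides z y≡zB =
  divides z (trans x≡yA (trans (cong (_* A) y≡zB) (trans (*-assoc z B A) (cong (z *_) (*-comm B A)))))

coprime-^ˡ : ∀ {p M} → Coprime p M → ∀ v → Coprime (p ^ v) M
coprime-^ˡ c zero    (d∣1 , _) = ∣1⇒≡1 d∣1
coprime-^ˡ c (suc v) = coprime-*ˡ c (coprime-^ˡ c v)

split-off-power : ∀ p → 2 ≤ p → ∀ N L → L ≤ N → 1 ≤ L → ∃[ v ] ∃[ M ] (L ≡ p ^ v * M × ¬ p ∣ M)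
split-off-power p 2≤p zero    L L≤0 1≤L = ⊥-elim (<⇒≱ 1≤L L≤0)
split-off-power p 2≤p (suc N) L L≤N 1≤L with p ∣? L
... | no  p∤L = 0 , L , sym (+-identityʳ L) , p∤L
... | yes p∣L with proper-cofactor 2≤p 1≤L p∣L
...   | j , L≡pj , 1≤j , j<L with split-off-power p 2≤p N j (≤-pred (≤-trans j<L L≤N)) 1≤j
...     | v , M , j≡ , p∤M = suc v , M , trans L≡pj (trans (cong (p *_) j≡) (sym (*-assoc p (p ^ v) M))) , p∤M

primePower⊎coprimeSplit : ∀ L → 2 ≤ L →
  (∃[ p ] ∃[ a ] (Prime p × L ≡ p ^ suc a)) ⊎ (∃[ A ] ∃[ B ] (2 ≤ A × 2 ≤ B × L ≡ A * B × Coprime A B))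
primePower⊎coprimeSplit L 2≤L with prime-divisor L 2≤L
... | p , pr , p∣L with split-off-power p (prime≥2 pr) L L ≤-refl (≤-trans (s≤s z≤n) 2≤L)
... | zero , M , e , p∤M = ⊥-elim (p∤M (subst (p ∣_) (trans e (+-identityʳ M)) p∣L))
... | suc a , zero , e , _ = ⊥-elim (<⇒≱ 2≤L (≤-trans (≤-reflexive (trans e (*-zeroʳ (p ^ suc a)))) z≤n))
... | suc a , suc zero , e , _ = inj₁ (p , a , pr , trans e (*-identityʳ _))
... | suc a , suc (suc M) , e , p∤M =
  inj₂ (p ^ suc a , suc (suc M) , 2≤^ (suc a) (prime≥2 pr) (s≤s z≤n) , s≤s (s≤s z≤n) , e , coprime-^ˡ (prime⇒coprime-nonmultiple pr p∤M) (suc a))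

firstIdx-finds : ∀ t b e → e < b → t e ≡ true → t (firstIdx t b) ≡ true × firstIdx t b < b
firstIdx-finds t (suc b) e e<b te with t 0 in t0
... | true  = t0 , s≤s z≤n
... | false with e
...   | zero = ⊥-elim (false≢true (trans (sym t0) te))
  where
  false≢true : false ≢ true
  false≢true ()
...   | suc e′ with firstIdx-finds (t ∘ suc) b e′ (≤-pred e<b) te
...     | found , bound = found , s≤s bound

⌊⌋-true⇒ : ∀ {a b : ℕ} → ⌊ a ≟ b ⌋ ≡ true → a ≡ b
⌊⌋-true⇒ {a} {b} e with a ≟ b
... | yes a≡b = a≡b
... | no  _ with e
...   | ()

Fin-injective⇒surjective : ∀ N (h : Fin N → Fin N) → (∀ i j → h i ≡ h j → i ≡ j) → ∀ t → ∃ λ i → h i ≡ t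
Fin-injective⇒surjective zero    h inj ()
Fin-injective⇒surjective (suc N) h inj t with any? (λ i → h i Fin.≟ t)
... | yes hit = hit
... | no miss with pigeonhole (n<1+n N) squeeze
  where
  squeeze : Fin (suc N) → Fin N
  squeeze i = punchOut {i = t} {j = h i} (λ e → miss (i , sym e))
... | i , j , i<j , e = ⊥-elim (<⇒≢ i<j (cong toℕ (inj i j
        (punchOut-injective {i = t} (λ e′ → miss (i , sym e′)) (λ e′ → miss (j , sym e′)) e))))

-- Fix a prime p = q + 1 and a primitive root g modulo p.  Then
-- e ↦ g^e is a bijection {0..q-1} → (ℤ/p)^×, so log = logg p g is its
-- inverse and log (a·b) ≡ log a + log b (mod q).
module DiscreteLog (q : ℕ) (1≤q : 1 ≤ q) (pr : Prime (suc q)) (g : ℕ) (prim : IsPrimitiveRoot (suc q) g) where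

  p : ℕ
  p = suc q

  instance
    q≢0 : NonZero q
    q≢0 = >-nonZero 1≤q

  2≤p : 2 ≤ p
  2≤p = s≤s 1≤q

  1%p≡1 : 1 % p ≡ 1
  1%p≡1 = m<n⇒m%n≡m (s≤s 1≤q)

  g^q≡1 : g ^ q % p ≡ 1
  g^q≡1 = trans (proj₁ prim) 1%p≡1

  g^e≢1 : ∀ e → 0 < e → e < q → g ^ e % p ≢ 1
  g^e≢1 e 0<e e<q x = proj₂ prim e 0<e e<q (trans x (sym 1%p≡1))

  *-congˡ-mod : ∀ x x′ y → x % p ≡ x′ % p → (x * y) % p ≡ (x′ * y) % p
  *-congˡ-mod x x′ y e = trans (%-distribˡ-* x y p) (trans (cong (λ z → (z * (y % p)) % p) e) (sym (%-distribˡ-* x′ y p)))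

  *-congʳ-mod : ∀ x y y′ → y % p ≡ y′ % p → (x * y) % p ≡ (x * y′) % p
  *-congʳ-mod x y y′ e = trans (cong (_% p) (*-comm x y)) (trans (*-congˡ-mod y y′ x e) (cong (_% p) (*-comm y′ x)))

  p∤*  : ∀ a b → ¬ p ∣ a → ¬ p ∣ b → ¬ p ∣ a * b
  p∤* a b p∤a p∤b p∣ab with euclidsLemma a b pr p∣ab
  ... | inj₁ p∣a = p∤a p∣a
  ... | inj₂ p∣b = p∤b p∣b

  p∤g : ¬ p ∣ g
  p∤g p∣g = 0≢1 (trans (sym (n∣m⇒m%n≡0 (g ^ q) p (∣-trans p∣g (g∣g^ q 1≤q)))) g^q≡1)
    where
    0≢1 : 0 ≢ 1
    0≢1 ()
    g∣g^ : ∀ k → 1 ≤ k → g ∣ g ^ k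
    g∣g^ (suc k) _ = m∣m*n (g ^ k)

  p∤g^ : ∀ e → ¬ p ∣ g ^ e
  p∤g^ zero    p∣1 = <⇒≱ (s≤s 1≤q) (∣⇒≤ p∣1)
  p∤g^ (suc e) = p∤* g (g ^ e) p∤g (p∤g^ e)

  %-+-same⇒∣ : ∀ a b → (a + b) % p ≡ a % p → p ∣ b
  %-+-same⇒∣ a b e = ∣m+n∣m⇒∣n (subst (p ∣_) (sym rewritten) (n∣m*n ((a + b) / p))) (n∣m*n (a / p))
    where
    open ≡-Reasoning
    rewritten : (a / p) * p + b ≡ ((a + b) / p) * p
    rewritten = +-cancelˡ-≡ (a % p) _ _ (begin
      a % p + ((a / p) * p + b)        ≡⟨ +-assoc (a % p) _ b ⟨
      (a % p + (a / p) * p) + b        ≡⟨ cong (_+ b) (m≡m%n+[m/n]*n a p) ⟨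
      a + b                            ≡⟨ m≡m%n+[m/n]*n (a + b) p ⟩
      (a + b) % p + ((a + b) / p) * p  ≡⟨ cong (_+ ((a + b) / p) * p) e ⟩
      a % p + ((a + b) / p) * p        ∎)

  multiple-below-p≡0 : ∀ e → e < p → p ∣ e → e ≡ 0
  multiple-below-p≡0 zero    _   _   = refl
  multiple-below-p≡0 (suc e) e<p p∣e = ⊥-elim (<⇒≱ e<p (∣⇒≤ p∣e))

  *-cancel-mod : ∀ x y z → ¬ p ∣ x → (x * y) % p ≡ (x * z) % p → y % p ≡ z % p
  *-cancel-mod x y z p∤x e = trans (sym (m%n%n≡m%n y p)) (trans reduced (m%n%n≡m%n z p))
    where
    on-residues : (x * (y % p)) % p ≡ (x * (z % p)) % p
    on-residues = trans (*-congʳ-mod x (y % p) y (m%n%n≡m%n y p)) (trans e (*-congʳ-mod x z (z % p) (sym (m%n%n≡m%n z p))))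
    -- for residues u ≤ w < p, the difference w - u is a multiple of p, so 0
    ordered : ∀ u w → u ≤ w → w < p → (x * u) % p ≡ (x * w) % p → u % p ≡ w % p
    ordered u w u≤w w<p eq with m≤n⇒∃[o]m+o≡n u≤w
    ... | k , u+k≡w = cong (_% p) (trans (sym (+-identityʳ u)) (trans (cong (u +_) (sym k≡0)) u+k≡w))
      where
      p∣xk : p ∣ x * k
      p∣xk = %-+-same⇒∣ (x * u) (x * k)
               (trans (cong (_% p) (trans (sym (*-distribˡ-+ x u k)) (cong (x *_) u+k≡w))) (sym eq))
      k≡0 : k ≡ 0
      k≡0 with euclidsLemma x k pr p∣xk
      ... | inj₁ p∣x = ⊥-elim (p∤x p∣x)
      ... | inj₂ p∣k = multiple-below-p≡0 k (≤-<-trans (m≤n+m k u) (subst (_< p) (sym u+k≡w) w<p)) p∣k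
    reduced : y % p % p ≡ z % p % p
    reduced with ≤-total (y % p) (z % p)
    ... | inj₁ le = ordered (y % p) (z % p) le (m%n<n z p) on-residues
    ... | inj₂ le = sym (ordered (z % p) (y % p) le (m%n<n y p) (sym on-residues))

  g^-injective-≤ : ∀ i j → i ≤ j → j < q → g ^ i % p ≡ g ^ j % p → i ≡ j
  g^-injective-≤ i j i≤j j<q e with m≤n⇒∃[o]m+o≡n i≤j
  ... | zero  , i+0≡j = trans (sym (+-identityʳ i)) i+0≡j
  ... | suc k , i+k≡j = ⊥-elim (g^e≢1 (suc k) (s≤s z≤n) (≤-<-trans (m≤n+m (suc k) i) (subst (_< q) (sym i+k≡j) j<q)) g^k≡1)
    where
    shifted : (g ^ i * 1) % p ≡ (g ^ i * g ^ suc k) % p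
    shifted = trans (cong (_% p) (*-identityʳ (g ^ i)))
      (trans e (cong (_% p) (trans (cong (g ^_) (sym i+k≡j)) (^-distribˡ-+-* g i (suc k)))))
    g^k≡1 : g ^ suc k % p ≡ 1
    g^k≡1 = trans (sym (*-cancel-mod (g ^ i) 1 (g ^ suc k) (p∤g^ i) shifted)) 1%p≡1

  g^-injective : ∀ i j → i < q → j < q → g ^ i % p ≡ g ^ j % p → i ≡ j
  g^-injective i j i<q j<q e with ≤-total i j
  ... | inj₁ i≤j = g^-injective-≤ i j i≤j j<q e
  ... | inj₂ j≤i = sym (g^-injective-≤ j i j≤i i<q (sym e))

  g^q^k≡1 : ∀ k → (g ^ q) ^ k % p ≡ 1
  g^q^k≡1 zero    = 1%p≡1
  g^q^k≡1 (suc k) = trans (%-distribˡ-* (g ^ q) ((g ^ q) ^ k) p)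
                          (trans (cong₂ (λ a b → (a * b) % p) g^q≡1 (g^q^k≡1 k)) 1%p≡1)

  -- g has order q, so g^i only depends on i mod q
  g^-mod-q : ∀ i → g ^ i % p ≡ g ^ (i % q) % p
  g^-mod-q i = begin
    g ^ i % p                                 ≡⟨ cong (λ z → g ^ z % p) (m≡m%n+[m/n]*n i q) ⟩
    g ^ (i % q + (i / q) * q) % p             ≡⟨ cong (_% p) (^-distribˡ-+-* g (i % q) ((i / q) * q)) ⟩
    (g ^ (i % q) * g ^ ((i / q) * q)) % p     ≡⟨ cong (λ z → (g ^ (i % q) * z) % p) (trans (cong (g ^_) (*-comm (i / q) q)) (sym (^-*-assoc g q (i / q)))) ⟩
    (g ^ (i % q) * (g ^ q) ^ (i / q)) % p     ≡⟨ *-congʳ-mod (g ^ (i % q)) ((g ^ q) ^ (i / q)) 1 (trans (g^q^k≡1 (i / q)) (sym 1%p≡1)) ⟩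
    (g ^ (i % q) * 1) % p                     ≡⟨ cong (_% p) (*-identityʳ (g ^ (i % q))) ⟩
    g ^ (i % q) % p                           ∎
    where open ≡-Reasoning

  g^≡⇒exponents≡ : ∀ i j → g ^ i % p ≡ g ^ j % p → i % q ≡ j % q
  g^≡⇒exponents≡ i j e =
    g^-injective (i % q) (j % q) (m%n<n i q) (m%n<n j q) (trans (sym (g^-mod-q i)) (trans e (g^-mod-q j)))

  residue≥1 : ∀ u → ¬ p ∣ u → 1 ≤ u % p
  residue≥1 u p∤u with u % p in eu
  ... | zero  = ⊥-elim (p∤u (m%n≡0⇒n∣m u p eu))
  ... | suc _ = s≤s z≤n

  -- the nonzero residues, as elements of Fin q
  unitIndex : ℕ → Fin q
  unitIndex u = fromℕ< {u % p ∸ 1} (below (u % p) (m%n<n u p))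
    where
    below : ∀ x → x < suc q → x ∸ 1 < q
    below zero    _          = 1≤q
    below (suc x) (s≤s x<q) = x<q

  unitIndex-injective : ∀ u v → ¬ p ∣ u → ¬ p ∣ v → unitIndex u ≡ unitIndex v → u % p ≡ v % p
  unitIndex-injective u v p∤u p∤v e = begin
    u % p            ≡⟨ m∸n+n≡m (residue≥1 u p∤u) ⟨
    (u % p ∸ 1) + 1  ≡⟨ cong (_+ 1) (trans (sym (toℕ-fromℕ< _)) (trans (cong toℕ e) (toℕ-fromℕ< _))) ⟩
    (v % p ∸ 1) + 1  ≡⟨ m∸n+n≡m (residue≥1 v p∤v) ⟩
    v % p            ∎
    where open ≡-Reasoning

  g^-surjective : ∀ u → ¬ p ∣ u → ∃[ e ] (e < q × g ^ e % p ≡ u % p)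
  g^-surjective u p∤u with Fin-injective⇒surjective q power power-injective (unitIndex u)
    where
    power : Fin q → Fin q
    power i = unitIndex (g ^ toℕ i)
    power-injective : ∀ i j → power i ≡ power j → i ≡ j
    power-injective i j e = toℕ-injective (g^-injective (toℕ i) (toℕ j) (toℕ<n i) (toℕ<n j)
      (unitIndex-injective (g ^ toℕ i) (g ^ toℕ j) (p∤g^ (toℕ i)) (p∤g^ (toℕ j)) e))
  ... | i , e = toℕ i , toℕ<n i , unitIndex-injective (g ^ toℕ i) u (p∤g^ (toℕ i)) p∤u e

  log : ℕ → ℕ
  log u = logg p g u

  log-spec : ∀ u → ¬ p ∣ u → g ^ log u % p ≡ u % p × log u < q
  log-spec u p∤u with g^-surjective u p∤u
  ... | e , e<q , g^e≡u with firstIdx-finds (λ e → ⌊ (g ^ e) % p ≟ u % p ⌋) q e e<q (trans (isYes≗does ((g ^ e) % p ≟ u % p)) (dec-true ((g ^ e) % p ≟ u % p) g^e≡u))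
  ...   | found , bound = ⌊⌋-true⇒ found , bound

  log-cong : ∀ u v → u % p ≡ v % p → log u ≡ log v
  log-cong u v e = cong (λ w → firstIdx (λ e → ⌊ (g ^ e) % p ≟ w ⌋) q) e

  log-* : ∀ a b → ¬ p ∣ a → ¬ p ∣ b → (log a + log b) % q ≡ log (a * b) % q
  log-* a b p∤a p∤b = g^≡⇒exponents≡ (log a + log b) (log (a * b)) (begin
    g ^ (log a + log b) % p      ≡⟨ cong (_% p) (^-distribˡ-+-* g (log a) (log b)) ⟩
    (g ^ log a * g ^ log b) % p  ≡⟨ *-congˡ-mod (g ^ log a) a (g ^ log b) (proj₁ (log-spec a p∤a)) ⟩
    (a * g ^ log b) % p          ≡⟨ *-congʳ-mod a (g ^ log b) b (proj₁ (log-spec b p∤b)) ⟩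
    (a * b) % p                  ≡⟨ proj₁ (log-spec (a * b) (p∤* a b p∤a p∤b)) ⟨
    g ^ log (a * b) % p          ∎)
    where open ≡-Reasoning

  log1≡0 : log 1 ≡ 0
  log1≡0 = g^-injective (log 1) 0 (proj₂ (log-spec 1 p∤1)) 1≤q (proj₁ (log-spec 1 p∤1))
    where
    p∤1 : ¬ p ∣ 1
    p∤1 p∣1 = <⇒≱ (s≤s 1≤q) (∣⇒≤ p∣1)

-- The Toeplitz word of a
-- one-gap pattern of length L is periodic off the multiples of L; the
-- lemmas below show what this forces on a completely additive τ.
module CompletelyAdditiveSeq {n : ℕ} (τ : ℕ → Sym n) (ca : CompletelyAdditive τ) where

  τ-one : τ 1 ≡ fzero
  τ-one = proj₁ ca

  τ-* : ∀ a b → 1 ≤ a → 1 ≤ b → τ (a * b) ≡ τ a ⊕ τ b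
  τ-* = proj₂ ca

  vanishes-of-constant-on-multiples : ∀ L → 1 ≤ L → (∀ t → 1 ≤ t → τ (L * t) ≡ τ L) → ∀ t → 1 ≤ t → τ t ≡ fzero
  vanishes-of-constant-on-multiples L 1≤L h t 1≤t = ⊕-fixed⇒0 (τ L) (τ t) (trans (sym (τ-* L t 1≤L 1≤t)) (h t 1≤t))

  PeriodicOffMultiples : ℕ → Set
  PeriodicOffMultiples L = ∀ m q → 1 ≤ m → ¬ L ∣ m → τ (m + q * L) ≡ τ m

  -- For L = X·Y, such periodicity makes τ t depend only on t mod X
  -- (when X ∤ t): compare τ Y ⊕ τ t = τ (Y t) = τ (Y (t mod X)) = τ Y ⊕ τ (t mod X).
  module _ {L : ℕ} (periodic : PeriodicOffMultiples L) where

    τ-residue : ∀ X Y .{{_ : NonZero X}} → 1 ≤ Y → L ≡ X * Y → ∀ t → 1 ≤ t → ¬ X ∣ t → τ t ≡ τ (t % X)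
    τ-residue X Y 1≤Y L≡XY t 1≤t X∤t = ⊕-cancelˡ (τ Y) (τ t) (τ r) (begin
      τ Y ⊕ τ t          ≡⟨ τ-* Y t 1≤Y 1≤t ⟨
      τ (Y * t)          ≡⟨ cong τ Yt≡ ⟩
      τ (Y * r + k * L)  ≡⟨ periodic (Y * r) k (*-mono-≤ 1≤Y 1≤r) L∤Yr ⟩
      τ (Y * r)          ≡⟨ τ-* Y r 1≤Y 1≤r ⟩
      τ Y ⊕ τ r          ∎)
      where
      open ≡-Reasoning
      r k : ℕ
      r = t % X
      k = t / X
      Yt≡ : Y * t ≡ Y * r + k * L
      Yt≡ = begin
        Y * t                ≡⟨ cong (Y *_) (m≡m%n+[m/n]*n t X) ⟩
        Y * (r + k * X)      ≡⟨ distribute Y r k X ⟩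
        Y * r + k * (X * Y)  ≡⟨ cong (λ z → Y * r + k * z) (sym L≡XY) ⟩
        Y * r + k * L        ∎
        where
        distribute : ∀ Y r k X → Y * (r + k * X) ≡ Y * r + k * (X * Y)
        distribute = solve-∀
      1≤r : 1 ≤ r
      1≤r with r in r≡
      ... | zero  = ⊥-elim (X∤t (m%n≡0⇒n∣m t X r≡))
      ... | suc _ = s≤s z≤n
      L∤Yr : ¬ L ∣ Y * r
      L∤Yr L∣Yr = <⇒≱ (m%n<n t X) (∣⇒≤ {{>-nonZero 1≤r}} X∣r)
        where
        X∣r : X ∣ r
        X∣r = *-cancelˡ-∣ Y {{>-nonZero 1≤Y}} (subst (_∣ Y * r) (trans L≡XY (*-comm X Y)) L∣Yr)

    module CoprimeSplit (A B : ℕ) (2≤A : 2 ≤ A) (2≤B : 2 ≤ B) (L≡AB : L ≡ A * B) (A⊥B : Coprime A B) where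

      -- an x not divisible by Y is shifted by a multiple of Y into the
      -- class 1 mod X; both moves keep τ unchanged, and τ 1 = 0
      vanishes-off-multiples : ∀ X Y → 2 ≤ X → 2 ≤ Y → L ≡ X * Y → Coprime Y X → ∀ x → 1 ≤ x → ¬ Y ∣ x → τ x ≡ fzero
      vanishes-off-multiples X Y 2≤X 2≤Y L≡XY Y⊥X x 1≤x Y∤x with bezout-shift X Y 2≤X Y⊥X x 1≤x
      ... | j , k , shifted = begin
        τ x        ≡⟨ τ-residue Y X (≤-trans (s≤s z≤n) 2≤X) L≡YX x 1≤x Y∤x ⟩
        τ (x % Y)  ≡⟨ cong τ (sym y≡x-mod-Y) ⟩
        τ (y % Y)  ≡⟨ τ-residue Y X (≤-trans (s≤s z≤n) 2≤X) L≡YX y 1≤y Y∤y ⟨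
        τ y        ≡⟨ τ-residue X Y (≤-trans (s≤s z≤n) 2≤Y) L≡XY y 1≤y X∤y ⟩
        τ (y % X)  ≡⟨ cong τ y≡1-mod-X ⟩
        τ 1        ≡⟨ τ-one ⟩
        fzero      ∎
        where
        open ≡-Reasoning
        instance
          X≢0 : NonZero X
          X≢0 = >-nonZero (≤-trans (s≤s z≤n) 2≤X)
          Y≢0 : NonZero Y
          Y≢0 = >-nonZero (≤-trans (s≤s z≤n) 2≤Y)
        y : ℕ
        y = x + Y * j
        L≡YX : L ≡ Y * X
        L≡YX = trans L≡XY (*-comm X Y)
        1≤y : 1 ≤ y
        1≤y = subst (1 ≤_) (sym shifted) (s≤s z≤n)
        y≡x-mod-Y : y % Y ≡ x % Y
        y≡x-mod-Y = trans (cong (λ z → (x + z) % Y) (*-comm Y j)) ([m+kn]%n≡m%n x j Y)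
        Y∤y : ¬ Y ∣ y
        Y∤y Y∣y = Y∤x (m%n≡0⇒n∣m x Y (trans (sym y≡x-mod-Y) (n∣m⇒m%n≡0 y Y Y∣y)))
        y≡1-mod-X : y % X ≡ 1
        y≡1-mod-X = trans (cong (_% X) shifted) (trans ([m+kn]%n≡m%n 1 k X) (m<n⇒m%n≡m 2≤X))
        X∤y : ¬ X ∣ y
        X∤y X∣y with trans (sym y≡1-mod-X) (n∣m⇒m%n≡0 y X X∣y)
        ... | ()

      vanishes-off-B : ∀ x → 1 ≤ x → ¬ B ∣ x → τ x ≡ fzero
      vanishes-off-B = vanishes-off-multiples A B 2≤A 2≤B L≡AB (Coprime.sym A⊥B)

      vanishes-off-A : ∀ x → 1 ≤ x → ¬ A ∣ x → τ x ≡ fzero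
      vanishes-off-A = vanishes-off-multiples B A 2≤B 2≤A (trans L≡AB (*-comm A B)) A⊥B

      τA≡0 : τ A ≡ fzero
      τA≡0 = vanishes-off-B A (≤-trans (s≤s z≤n) 2≤A) (λ B∣A → <⇒≢ 2≤B (sym (A⊥B (B∣A , ∣-refl))))

      τB≡0 : τ B ≡ fzero
      τB≡0 = vanishes-off-A B (≤-trans (s≤s z≤n) 2≤B) (λ A∣B → <⇒≢ 2≤A (sym (A⊥B (∣-refl , A∣B))))

      2≤AB : 2 ≤ A * B
      2≤AB = ≤-trans 2≤A (m≤m*n A B {{>-nonZero (≤-trans (s≤s z≤n) 2≤B)}})

      τAB≡0 : τ (A * B) ≡ fzero
      τAB≡0 = trans (τ-* A B (≤-trans (s≤s z≤n) 2≤A) (≤-trans (s≤s z≤n) 2≤B))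
                    (trans (cong₂ _⊕_ τA≡0 τB≡0) (⊕-identityˡ fzero))

      -- a multiple of A and of B is a multiple A·B·j, and τ (A·B·j) = τ j
      vanishes : ∀ x → 1 ≤ x → τ x ≡ fzero
      vanishes = <-rec (λ x → 1 ≤ x → τ x ≡ fzero) step
        where
        step : ∀ x → (∀ {z} → z < x → 1 ≤ z → τ z ≡ fzero) → 1 ≤ x → τ x ≡ fzero
        step x smaller 1≤x with B ∣? x
        ... | no  B∤x = vanishes-off-B x 1≤x B∤x
        ... | yes B∣x with A ∣? x
        ...   | no  A∤x = vanishes-off-A x 1≤x A∤x
        ...   | yes A∣x with proper-cofactor 2≤AB 1≤x (coprime-∣-* A⊥B A∣x B∣x)
        ...     | j , x≡ABj , 1≤j , j<x = begin
          τ x                  ≡⟨ cong τ x≡ABj ⟩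
          τ (A * B * j)        ≡⟨ τ-* (A * B) j (≤-trans (s≤s z≤n) 2≤AB) 1≤j ⟩
          τ (A * B) ⊕ τ j      ≡⟨ cong₂ _⊕_ τAB≡0 (smaller j<x 1≤j) ⟩
          fzero ⊕ fzero        ≡⟨ ⊕-identityˡ fzero ⟩
          fzero                ∎
          where open ≡-Reasoning

  module PrimePowerPeriod (q : ℕ) (1≤q : 1 ≤ q) (pr : Prime (suc q)) (g : ℕ) (prim : IsPrimitiveRoot (suc q) g)
                          (a : ℕ) (periodic : PeriodicOffMultiples (suc q ^ suc a)) where
    open DiscreteLog q 1≤q pr g prim

    units-positive : ∀ u → ¬ p ∣ u → 1 ≤ u
    units-positive zero    p∤0 = ⊥-elim (p∤0 (divides 0 refl))
    units-positive (suc u) _   = s≤s z≤n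

    τ-unit-residue : ∀ u v → ¬ p ∣ u → u % p ≡ v % p → τ u ≡ τ v
    τ-unit-residue u v p∤u u≡v = begin
      τ u        ≡⟨ τ-residue periodic p (p ^ a) (m^n>0 p a) refl u (units-positive u p∤u) p∤u ⟩
      τ (u % p)  ≡⟨ cong τ u≡v ⟩
      τ (v % p)  ≡⟨ τ-residue periodic p (p ^ a) (m^n>0 p a) refl v (units-positive v p∤v) p∤v ⟨
      τ v        ∎
      where
      open ≡-Reasoning
      p∤v : ¬ p ∣ v
      p∤v p∣v = p∤u (m%n≡0⇒n∣m u p (trans u≡v (n∣m⇒m%n≡0 v p p∣v)))

    τ-g^ : ∀ e → τ (g ^ e) ≡ e ⊙ τ g
    τ-g^ zero    = τ-one
    τ-g^ (suc e) = trans (τ-* g (g ^ e) (units-positive g p∤g) (units-positive (g ^ e) (p∤g^ e)))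
                         (cong (τ g ⊕_) (τ-g^ e))

    τ-unit : ∀ u → ¬ p ∣ u → τ u ≡ log u ⊙ τ g
    τ-unit u p∤u = trans (τ-unit-residue u (g ^ log u) p∤u (sym (proj₁ (log-spec u p∤u)))) (τ-g^ (log u))

    q⊙τg≡0 : q ⊙ τ g ≡ fzero
    q⊙τg≡0 = trans (sym (τ-g^ q)) (trans (τ-unit-residue (g ^ q) 1 (p∤g^ q) (trans g^q≡1 (sym 1%p≡1))) τ-one)

module DividesΣ-characterisation {n : ℕ} (q : ℕ) where

  private
    K′ : ℕ
    K′ = suc n

  d : ℕ
  d = gcd q K′

  instance
    d≢0 : NonZero d
    d≢0 = ≢-nonZero (gcd[m,n]≢0 q K′ (inj₂ (λ ())))

  K/d q/d : ℕ
  K/d = K′ / d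
  q/d = q / d

  ξ≡K/d : ξ q K′ ≡ K/d
  ξ≡K/d = divSafe≡/ K′ d
    where
    divSafe≡/ : ∀ a b .{{_ : NonZero b}} → divSafe a b ≡ a / b
    divSafe≡/ a (suc b) = refl

  K≡ : K′ ≡ K/d * d
  K≡ = sym (m/n*n≡m (gcd[m,n]∣n q K′))

  q≡ : q ≡ q/d * d
  q≡ = sym (m/n*n≡m (gcd[m,n]∣m q K′))

  K/d⊥q/d : Coprime K/d q/d
  K/d⊥q/d = Coprime.sym (coprime-/gcd q K′)

  1≤K/d : 1 ≤ K/d
  1≤K/d with K/d in K/d≡
  ... | zero  = ⊥-elim (K≢0 (trans K≡ (cong (_* d) K/d≡)))
    where
    K≢0 : K′ ≢ 0 * d
    K≢0 ()
  ... | suc _ = s≤s z≤n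

  ξ-divides⇒q⊙≡0 : ∀ (c : Sym n) → DividesΣ (ξ q K′) c → q ⊙ c ≡ fzero
  ξ-divides⇒q⊙≡0 c (c′ , c≡) = begin
    q ⊙ c               ≡⟨ cong (q ⊙_) (trans c≡ (cong (_⊙ c′) ξ≡K/d)) ⟩
    q ⊙ (K/d ⊙ c′)      ≡⟨ ⊙-assoc q K/d c′ ⟨
    (q * K/d) ⊙ c′      ≡⟨ cong (_⊙ c′) qK/d≡ ⟩
    (q/d * K′) ⊙ c′     ≡⟨ ⊙-assoc q/d K′ c′ ⟩
    q/d ⊙ (K′ ⊙ c′)     ≡⟨ cong (q/d ⊙_) (K⊙≡0 c′) ⟩
    q/d ⊙ fzero         ≡⟨ ⊙-zero q/d ⟩
    fzero               ∎
    where
    open ≡-Reasoning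
    regroup : ∀ a b c → a * b * c ≡ a * (c * b)
    regroup = solve-∀
    qK/d≡ : q * K/d ≡ q/d * K′
    qK/d≡ = trans (cong (_* K/d) q≡) (trans (regroup q/d d K/d) (cong (q/d *_) (sym K≡)))

  -- K ∣ q·c gives K/d ∣ (q/d)·c, hence K/d ∣ c by coprimality
  q⊙≡0⇒ξ-divides : ∀ (c : Sym n) → q ⊙ c ≡ fzero → DividesΣ (ξ q K′) c
  q⊙≡0⇒ξ-divides c q⊙c≡0 with coprime-divisor {o = toℕ c} K/d⊥q/d K/d∣q/d*c
    where
    regroup : ∀ a b c → a * b * c ≡ b * (a * c)
    regroup = solve-∀
    K∣qc : K′ ∣ q * toℕ c
    K∣qc = m%n≡0⇒n∣m (q * toℕ c) K′ (trans (sym (toℕ-⊙ q c)) (cong toℕ q⊙c≡0))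
    K/d∣q/d*c : K/d ∣ q/d * toℕ c
    K/d∣q/d*c = *-cancelˡ-∣ d (subst₂ _∣_ (trans K≡ (*-comm K/d d)) (trans (cong (_* toℕ c) q≡) (regroup q/d d (toℕ c))) K∣qc)
  ... | divides c′ c≡ = fromℕ< c′<K , trans (toℕ-injective (trans (sym (toℕ%K c)) (sym K/d⊙c′≡c))) (cong (_⊙ fromℕ< c′<K) (sym ξ≡K/d))
    where
    c′<K : c′ < K′
    c′<K = ≤-<-trans (m≤m*n c′ K/d {{>-nonZero 1≤K/d}}) (subst (_< K′) c≡ (toℕ<n c))
    K/d⊙c′≡c : toℕ (K/d ⊙ fromℕ< c′<K) ≡ toℕ c % K′
    K/d⊙c′≡c = trans (toℕ-⊙ K/d (fromℕ< c′<K)) (cong (_% K′) (trans (cong (K/d *_) (toℕ-fromℕ< c′<K)) (trans (*-comm K/d c′) (sym c≡))))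

module _ {n : ℕ} where

  segment : (ℕ → Sym n) → ℕ → ℕ → List (Letter n)
  segment t s zero    = []
  segment t s (suc L) = inj₁ (t s) ∷ segment t (suc s) L

  segment-gapFree : ∀ t s L → numGapsL (segment t s L) ≡ 0
  segment-gapFree t s zero    = refl
  segment-gapFree t s (suc L) = segment-gapFree t (suc s) L

  length-segment : ∀ t s L → List.length (segment t s L) ≡ L
  length-segment t s zero    = refl
  length-segment t s (suc L) = cong suc (length-segment t (suc s) L)

  segment-++ : ∀ t s a b → segment t s (a + b) ≡ segment t s a ++ segment t (s + a) b
  segment-++ t s zero    b = cong (λ z → segment t z b) (sym (+-identityʳ s))
  segment-++ t s (suc a) b = cong (inj₁ (t s) ∷_)
    (trans (segment-++ t (suc s) a b) (cong (λ z → segment t (suc s) a ++ segment t z b) (sym (+-suc s a))))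

  segment-cong : ∀ t u s L → (∀ i → i < L → t (s + i) ≡ u (s + i)) → segment t s L ≡ segment u s L
  segment-cong t u s zero    h = refl
  segment-cong t u s (suc L) h = cong₂ _∷_
    (cong inj₁ (trans (cong t (sym (+-identityʳ s))) (trans (h 0 (s≤s z≤n)) (cong u (+-identityʳ s)))))
    (segment-cong t u (suc s) L (λ i i<L → trans (cong t (sym (+-suc s i))) (trans (h (suc i) (s≤s i<L)) (cong u (+-suc s i)))))

  segment-shift : ∀ t a s L → segment (λ m → t (a + m)) s L ≡ segment t (a + s) L
  segment-shift t a s zero    = refl
  segment-shift t a s (suc L) = cong (inj₁ (t (a + s)) ∷_) (trans (segment-shift t a (suc s) L) (cong (λ z → segment t z L) (+-suc a s)))

  letterAt-segment : ∀ t s L i → i < L → letterAt (segment t s L) i ≡ inj₁ (t (s + i))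
  letterAt-segment t s (suc L) zero    _        = cong (λ z → inj₁ (t z)) (sym (+-identityʳ s))
  letterAt-segment t s (suc L) (suc i) (s≤s i<L) = trans (letterAt-segment t (suc s) L i i<L) (cong (λ z → inj₁ (t z)) (sym (+-suc s i)))

  segment-const : ∀ (a : Sym n) s L → segment (λ _ → a) s L ≡ replicate L (inj₁ a)
  segment-const a s zero    = refl
  segment-const a s (suc L) = cong (inj₁ a ∷_) (segment-const a (suc s) L)

  gapFree≡segment : ∀ (ws : List (Letter n)) t s → numGapsL ws ≡ 0 →
                    (∀ i → i < List.length ws → letterOr0 (letterAt ws i) ≡ t (s + i)) → ws ≡ segment t s (List.length ws)
  gapFree≡segment []            t s _  _ = refl
  gapFree≡segment (inj₁ a ∷ ws) t s gf h = cong₂ _∷_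
    (cong inj₁ (trans (h 0 (s≤s z≤n)) (cong t (+-identityʳ s))))
    (gapFree≡segment ws t (suc s) gf (λ i i< → trans (h (suc i) (s≤s i<)) (cong t (+-suc s i))))

module _ {n : ℕ} where

  applyGap : (Sym n → Sym n) → Letter n → Letter n
  applyGap h (inj₁ b) = inj₁ (h b)
  applyGap h (inj₂ g) = inj₂ (h ∘ g)

  toList-fill : ∀ (P : Pattern n) ys → toList (fill P ys) ≡ fillL (toList P) ys
  toList-fill (inj₁ a ∷ xs) ys            = refl
  toList-fill (inj₂ f ∷ xs) []            = refl
  toList-fill (inj₂ f ∷ xs) (inj₁ b ∷ ys) = refl
  toList-fill (inj₂ f ∷ xs) (inj₂ g ∷ ys) = refl

  fillL-gapFree-prefix : ∀ (ws zs ys : List (Letter n)) → numGapsL ws ≡ 0 → fillL (ws ++ zs) ys ≡ ws ++ fillL zs ys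
  fillL-gapFree-prefix []            zs ys _  = refl
  fillL-gapFree-prefix (inj₁ a ∷ ws) zs ys gf = cong (inj₁ a ∷_) (fillL-gapFree-prefix ws zs ys gf)

  fillL-gap : ∀ h (zs : List (Letter n)) y ys → fillL (inj₂ h ∷ zs) (y ∷ ys) ≡ applyGap h y ∷ fillL zs ys
  fillL-gap h zs (inj₁ b) ys = refl
  fillL-gap h zs (inj₂ g) ys = refl

  concatMap-++ : ∀ (F : Letter n → List (Letter n)) xs ys → List.concatMap F (xs ++ ys) ≡ List.concatMap F xs ++ List.concatMap F ys
  concatMap-++ F xs ys = trans (cong List.concat (map-++ F xs ys)) (sym (concat-++ (List.map F xs) (List.map F ys)))

  fill-power : ∀ (ws : List (Letter n)) h → numGapsL ws ≡ 0 → ∀ ys →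
               fillL (List.concat (replicate (List.length ys) (ws ++ inj₂ h ∷ []))) ys ≡ List.concatMap (λ y → ws ++ applyGap h y ∷ []) ys
  fill-power ws h gf []       = refl
  fill-power ws h gf (y ∷ ys) = begin
    fillL ((ws ++ inj₂ h ∷ []) ++ rest) (y ∷ ys)  ≡⟨ cong (λ z → fillL z (y ∷ ys)) (++-assoc ws (inj₂ h ∷ []) rest) ⟩
    fillL (ws ++ inj₂ h ∷ rest) (y ∷ ys)          ≡⟨ fillL-gapFree-prefix ws _ (y ∷ ys) gf ⟩
    ws ++ fillL (inj₂ h ∷ rest) (y ∷ ys)          ≡⟨ cong (ws ++_) (fillL-gap h rest y ys) ⟩
    ws ++ applyGap h y ∷ fillL rest ys            ≡⟨ cong (λ z → ws ++ applyGap h y ∷ z) (fill-power ws h gf ys) ⟩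
    ws ++ applyGap h y ∷ List.concatMap block ys  ≡⟨ ++-assoc ws (applyGap h y ∷ []) _ ⟨
    (ws ++ applyGap h y ∷ []) ++ List.concatMap block ys ∎
    where
    open ≡-Reasoning
    rest : List (Letter n)
    rest = List.concat (replicate (List.length ys) (ws ++ inj₂ h ∷ []))
    block : Letter n → List (Letter n)
    block y = ws ++ applyGap h y ∷ []

  toList-wpow : ∀ (P : Pattern n) N → toList (wpow P (suc N)) ≡ List.concat (replicate (suc N) (toList P))
  toList-wpow (x ∷ xs) N = refl

  ξ-1ˡ : ∀ m → ξ 1 m ≡ m
  ξ-1ˡ m = trans (cong (divSafe m) (gcd-zeroˡ m)) (n/1≡n m)

  ξ-1ʳ : ∀ m → ξ m 1 ≡ 1
  ξ-1ʳ m = cong (divSafe 1) (gcd-zeroʳ m)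

  toList-∘ₚ : ∀ (X Q : Pattern n) → numGaps X ≡ 1 →
              toList (X ∘ₚ Q) ≡ fillL (List.concat (replicate (len Q) (toList X))) (toList Q)
  toList-∘ₚ X Q@(y ∷ ys) one-gap with numGaps X
  ... | suc zero = begin
    toList (fill (wpow X (ξ 1 (len Q))) (toList (wpow Q (ξ (len Q) 1))))     ≡⟨ toList-fill _ _ ⟩
    fillL (toList (wpow X (ξ 1 (len Q)))) (toList (wpow Q (ξ (len Q) 1)))    ≡⟨ cong₂ (λ a b → fillL (toList (wpow X a)) (toList (wpow Q b))) (ξ-1ˡ (len Q)) (ξ-1ʳ (len Q)) ⟩
    fillL (toList (wpow X (len Q))) (toList (wpow Q 1))                      ≡⟨ cong₂ fillL (toList-wpow X (List.length ys)) (++-identityʳ (toList Q)) ⟩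
    fillL (List.concat (replicate (len Q) (toList X))) (toList Q)            ∎
    where open ≡-Reasoning

module RotationAtEnd {n : ℕ} (X : Pattern n) (first : FirstInΣ X) (q : ℕ) (d : Sym n) (ws : List (Letter n))
                     (shape : toList X ≡ ws ++ inj₂ (ρ d) ∷ []) (ws-gapFree : numGapsL ws ≡ 0) (|ws|≡q : List.length ws ≡ q) where
  open OneGap X first ws (ρ d) [] shape ws-gapFree refl public

  p : ℕ
  p = suc q

  period≡p : period ≡ p
  period≡p = trans period≡ (trans (+-comm gapIdx 1) (cong suc |ws|≡q))

  T-p* : ∀ j → 1 ≤ j → T X (p * j) ≡ T X j ⊕ d
  T-p* (suc s) _ = trans (cong (T X) position) (T-atGap s)
    where
    rearrange : ∀ q s → suc q * suc s ≡ s * suc q + suc q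
    rearrange = solve-∀
    position : p * suc s ≡ s * period + suc gapIdx
    position = trans (rearrange q s) (cong₂ (λ a b → s * a + suc b) (sym period≡p) (sym |ws|≡q))

  T-shift : ∀ s i → 1 ≤ i → i ≤ q → T X (p * s + i) ≡ T X i
  T-shift s (suc i) _ i<q = trans (cong (T X) reorder) (T-periodic (suc i) s (s≤s z≤n) off-gap)
    where
    reorder : p * s + suc i ≡ suc i + s * period
    reorder = trans (+-comm (p * s) (suc i)) (cong (suc i +_) (trans (*-comm p s) (cong (s *_) (sym period≡p))))
    off-gap : i % period ≢ gapIdx
    off-gap e = <⇒≢ i<q (trans (sym (m<n⇒m%n≡m (≤-trans (≤-trans i<q (n≤1+n q)) (≤-reflexive (sym period≡p))))) (trans e |ws|≡q))

  ws≡prefix : ∀ s → ws ≡ segment (T X) (p * s + 1) q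
  ws≡prefix s = trans prefix₀ (trans (segment-cong (T X) (λ m → T X (p * s + m)) 1 q (λ i i<q → sym (T-shift s (suc i) (s≤s z≤n) i<q)))
                                 (segment-shift (T X) (p * s) 1 q))
    where
    prefix₀ : ws ≡ segment (T X) 1 q
    prefix₀ = trans (gapFree≡segment ws (T X) 1 ws-gapFree letters) (cong (segment (T X) 1) |ws|≡q)
      where
      letters : ∀ i → i < List.length ws → letterOr0 (letterAt ws i) ≡ T X (1 + i)
      letters i i< = sym (trans (T-offGap (suc i) (s≤s z≤n) off-gap)
        (cong letterOr0 (trans (cong (letterAt xs) i%L≡i) (trans (cong (λ z → letterAt z i) shape) (letterAt-++ˡ ws _ i i<)))))
        where
        i%L≡i : i % period ≡ i
        i%L≡i = m<n⇒m%n≡m (≤-trans i< (<⇒≤ gapIdx<period))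
        off-gap : i % period ≢ gapIdx
        off-gap e = <⇒≢ i< (trans (sym i%L≡i) e)

  block : Letter n → List (Letter n)
  block y = ws ++ applyGap (ρ d) y ∷ []

  blocks≡segment : ∀ N s → List.concatMap block (segment (T X) (suc s) N) ++ ws ≡ segment (T X) (p * s + 1) (p * N + q)
  blocks≡segment zero    s = trans (ws≡prefix s) (cong (segment (T X) (p * s + 1)) (cong (_+ q) (sym (*-zeroʳ p))))
  blocks≡segment (suc N) s = begin
    ((ws ++ inj₁ (ρ d (T X (suc s))) ∷ []) ++ rest) ++ ws     ≡⟨ ++-assoc (ws ++ inj₁ (ρ d (T X (suc s))) ∷ []) rest ws ⟩
    (ws ++ inj₁ (ρ d (T X (suc s))) ∷ []) ++ (rest ++ ws)     ≡⟨ ++-assoc ws (inj₁ (ρ d (T X (suc s))) ∷ []) (rest ++ ws) ⟩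
    ws ++ inj₁ (ρ d (T X (suc s))) ∷ (rest ++ ws)             ≡⟨ cong₂ (λ a b → a ++ inj₁ b ∷ (rest ++ ws)) (ws≡prefix s) (sym (trans (cong (T X) end≡) (T-p* (suc s) (s≤s z≤n)))) ⟩
    segment (T X) (p * s + 1) q ++ inj₁ (T X (p * s + 1 + q)) ∷ (rest ++ ws)
      ≡⟨ cong (λ z → segment (T X) (p * s + 1) q ++ inj₁ (T X (p * s + 1 + q)) ∷ z) (blocks≡segment N (suc s)) ⟩
    segment (T X) (p * s + 1) q ++ inj₁ (T X (p * s + 1 + q)) ∷ segment (T X) (p * suc s + 1) (p * N + q)
      ≡⟨ cong (λ z → segment (T X) (p * s + 1) q ++ inj₁ (T X (p * s + 1 + q)) ∷ segment (T X) z (p * N + q)) (sym next≡) ⟩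
    segment (T X) (p * s + 1) q ++ segment (T X) (p * s + 1 + q) (suc (p * N + q))
      ≡⟨ segment-++ (T X) (p * s + 1) q (suc (p * N + q)) ⟨
    segment (T X) (p * s + 1) (q + suc (p * N + q))           ≡⟨ cong (segment (T X) (p * s + 1)) (length≡ q N) ⟩
    segment (T X) (p * s + 1) (p * suc N + q)                 ∎
    where
    open ≡-Reasoning
    rest : List (Letter n)
    rest = List.concatMap block (segment (T X) (suc (suc s)) N)
    end≡′ : ∀ q s → suc q * s + 1 + q ≡ suc q * suc s
    end≡′ = solve-∀
    end≡ : p * s + 1 + q ≡ p * suc s
    end≡ = end≡′ q s
    next≡ : suc (p * s + 1 + q) ≡ p * suc s + 1
    next≡ = trans (+-comm 1 (p * s + 1 + q)) (cong (_+ 1) end≡)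
    length≡ : ∀ q N → q + suc (suc q * N + q) ≡ suc q * suc N + q
    length≡ = solve-∀

  rotation-power : ℕ → Sym n → Sym n
  rotation-power k x = x ⊕ (k ⊙ d)

  composition-power : ∀ k → ∃[ h ] ((∀ x → h x ≡ rotation-power k x) ×
                                    toList (ppow X k) ≡ segment (T X) 1 (p ^ k ∸ 1) ++ inj₂ h ∷ [])
  composition-power zero    = id , (λ x → sym (⊕-identityʳ x)) , refl
  composition-power (suc k) with composition-power k
  ... | h , h≗ , Xᵏ≡ = ρ d ∘ h , ρh≗ , (begin
    toList (X ∘ₚ Xᵏ)                                                  ≡⟨ toList-∘ₚ X Xᵏ numGaps≡1 ⟩
    fillL (List.concat (replicate (len Xᵏ) (toList X))) (toList Xᵏ)   ≡⟨ cong₂ (λ a b → fillL (List.concat (replicate a b)) (toList Xᵏ)) (len≡length Xᵏ) shape ⟩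
    fillL (List.concat (replicate (List.length (toList Xᵏ)) (ws ++ inj₂ (ρ d) ∷ []))) (toList Xᵏ) ≡⟨ fill-power ws (ρ d) ws-gapFree (toList Xᵏ) ⟩
    List.concatMap block (toList Xᵏ)                                  ≡⟨ cong (List.concatMap block) Xᵏ≡ ⟩
    List.concatMap block (segment (T X) 1 N ++ inj₂ h ∷ [])           ≡⟨ concatMap-++ block (segment (T X) 1 N) (inj₂ h ∷ []) ⟩
    List.concatMap block (segment (T X) 1 N) ++ (block (inj₂ h) ++ []) ≡⟨ cong (List.concatMap block (segment (T X) 1 N) ++_) (++-identityʳ _) ⟩
    List.concatMap block (segment (T X) 1 N) ++ (ws ++ inj₂ (ρ d ∘ h) ∷ []) ≡⟨ ++-assoc (List.concatMap block (segment (T X) 1 N)) ws _ ⟨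
    (List.concatMap block (segment (T X) 1 N) ++ ws) ++ inj₂ (ρ d ∘ h) ∷ [] ≡⟨ cong (_++ inj₂ (ρ d ∘ h) ∷ []) (blocks≡segment N 0) ⟩
    segment (T X) (p * 0 + 1) (p * N + q) ++ inj₂ (ρ d ∘ h) ∷ []      ≡⟨ cong₂ (λ a b → segment (T X) a b ++ inj₂ (ρ d ∘ h) ∷ []) (cong (_+ 1) (*-zeroʳ p)) length≡ ⟩
    segment (T X) 1 (p ^ suc k ∸ 1) ++ inj₂ (ρ d ∘ h) ∷ []            ∎)
    where
    open ≡-Reasoning
    Xᵏ : Pattern n
    Xᵏ = ppow X k
    N : ℕ
    N = p ^ k ∸ 1
    ρh≗ : ∀ x → ρ d (h x) ≡ rotation-power (suc k) x
    ρh≗ x = trans (cong (_⊕ d) (h≗ x)) (trans (⊕-assoc x (k ⊙ d) d) (cong (x ⊕_) (sym (⊙-suc k d))))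
    length≡ : p * N + q ≡ p ^ suc k ∸ 1
    length≡ = from-positive (p ^ k) (m^n>0 p k)
      where
      rearrange : ∀ q M → suc q * suc M ≡ suc q * M + q + 1
      rearrange = solve-∀
      from-positive : ∀ P → 0 < P → p * (P ∸ 1) + q ≡ p * P ∸ 1
      from-positive (suc M) _ = sym (trans (cong (_∸ 1) (rearrange q M)) (m+n∸n≡m (p * M + q) 1))

module _ {n : ℕ} where

  first-letter : ∀ (X : Pattern n) a rest → toList X ≡ inj₁ a ∷ rest → FirstInΣ X
  first-letter (x ∷ xs) a rest e = a , cong (λ { [] → x ; (y ∷ _) → y }) e

  first-of-segment : ∀ (X : Pattern n) t s N rest → 1 ≤ N → toList X ≡ segment t s N ++ rest → FirstInΣ X
  first-of-segment X t s (suc N) rest _ e = first-letter X (t s) _ e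

  toList-lamPattern : ∀ p g (c d : Sym n) →
                      toList (lamPattern p g c d) ≡ List.map (λ j → inj₁ (j ⊙ c)) (lam p g) ++ inj₂ (ρ d) ∷ []
  toList-lamPattern p g c d with List.map {B = Letter n} (λ j → inj₁ (j ⊙ c)) (lam p g)
  ... | []     = refl
  ... | x ∷ xs = refl

  map-applyUpTo≡segment : ∀ (G : ℕ → Letter n) (F f : ℕ → ℕ) (t : ℕ → Sym n) s N →
                          (∀ i → G (F (f i)) ≡ inj₁ (t (s + i))) →
                          List.map G (List.map F (List.applyUpTo f N)) ≡ segment t s N
  map-applyUpTo≡segment G F f t s zero    h = refl
  map-applyUpTo≡segment G F f t s (suc N) h = cong₂ _∷_
    (trans (h 0) (cong (λ z → inj₁ (t z)) (+-identityʳ s)))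
    (map-applyUpTo≡segment G F (f ∘ suc) t (suc s) N (λ i → trans (h (suc i)) (cong (λ z → inj₁ (t z)) (+-suc s i))))

module LambdaPattern {n : ℕ} (q : ℕ) (1≤q : 1 ≤ q) (pr : Prime (suc q)) (g : ℕ) (prim : IsPrimitiveRoot (suc q) g)
                     (c d : Sym n) where
  open DiscreteLog q 1≤q pr g prim public

  X : Pattern n
  X = lamPattern p g c d

  μ : ℕ → Sym n
  μ m = log m ⊙ c

  shape : toList X ≡ segment μ 1 q ++ inj₂ (ρ d) ∷ []
  shape = trans (toList-lamPattern p g c d)
    (cong (_++ inj₂ (ρ d) ∷ []) (map-applyUpTo≡segment (λ j → inj₁ (j ⊙ c)) (λ i → logg p g (suc i)) id μ 1 q (λ i → refl)))

  first : FirstInΣ X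
  first = first-of-segment X μ 1 q _ 1≤q shape

  open RotationAtEnd X first q d (segment μ 1 q) shape (segment-gapFree μ 1 q) (length-segment μ 1 q) public hiding (p)

  m%L≡m%p : ∀ m → m % period ≡ m % p
  m%L≡m%p m = %-congʳ {o = m} period≡p

  T-unit : ∀ m → ¬ p ∣ m → T X m ≡ log m ⊙ c
  T-unit zero    p∤0 = ⊥-elim (p∤0 (divides 0 refl))
  T-unit (suc m) p∤m = begin
    T X (suc m)                                                ≡⟨ T-offGap (suc m) (s≤s z≤n) off-gap ⟩
    letterOr0 (letterAt xs (m % period))                       ≡⟨ cong (λ z → letterOr0 (letterAt xs z)) (m%L≡m%p m) ⟩
    letterOr0 (letterAt xs (m % p))                            ≡⟨ cong (λ z → letterOr0 (letterAt z (m % p))) shape ⟩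
    letterOr0 (letterAt (segment μ 1 q ++ inj₂ (ρ d) ∷ []) (m % p)) ≡⟨ cong letterOr0 (letterAt-++ˡ (segment μ 1 q) _ (m % p) (subst (m % p <_) (sym (length-segment μ 1 q)) r<q)) ⟩
    letterOr0 (letterAt (segment μ 1 q) (m % p))               ≡⟨ cong letterOr0 (letterAt-segment μ 1 q (m % p) r<q) ⟩
    log (suc (m % p)) ⊙ c                                      ≡⟨ cong (_⊙ c) (log-cong (suc (m % p)) (suc m) suc-residue) ⟩
    log (suc m) ⊙ c                                            ∎
    where
    open ≡-Reasoning
    r≢q : m % p ≢ q
    r≢q e = p∤m (last-in-block⇒∣ p (suc m) e (s≤s z≤n))
    r<q : m % p < q
    r<q = ≤∧≢⇒< (≤-pred (m%n<n m p)) r≢q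
    off-gap : m % period ≢ gapIdx
    off-gap e = r≢q (trans (sym (m%L≡m%p m)) (trans e (length-segment μ 1 q)))
    suc-residue : suc (m % p) % p ≡ suc m % p
    suc-residue = %-absorbʳ 1 m p

  T-one : T X 1 ≡ fzero
  T-one = trans (T-unit 1 (λ p∣1 → <⇒≱ (s≤s 1≤q) (∣⇒≤ p∣1))) (cong (_⊙ c) log1≡0)

  T-p^ : ∀ k j → 1 ≤ j → T X (p ^ k * j) ≡ T X j ⊕ (k ⊙ d)
  T-p^ zero    j _   = trans (cong (T X) (*-identityˡ j)) (sym (⊕-identityʳ (T X j)))
  T-p^ (suc k) j 1≤j = begin
    T X (p * p ^ k * j)       ≡⟨ cong (T X) (*-assoc p (p ^ k) j) ⟩
    T X (p * (p ^ k * j))     ≡⟨ T-p* (p ^ k * j) (*-mono-≤ (m^n>0 p k) 1≤j) ⟩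
    T X (p ^ k * j) ⊕ d       ≡⟨ cong (_⊕ d) (T-p^ k j 1≤j) ⟩
    (T X j ⊕ (k ⊙ d)) ⊕ d     ≡⟨ ⊕-assoc (T X j) (k ⊙ d) d ⟩
    T X j ⊕ ((k ⊙ d) ⊕ d)     ≡⟨ cong (T X j ⊕_) (⊙-suc k d) ⟨
    T X j ⊕ (suc k ⊙ d)       ∎
    where open ≡-Reasoning

  T-periodic-p^ : ∀ k m t → 1 ≤ m → ¬ p ^ k ∣ m → T X (m + t * p ^ k) ≡ T X m
  T-periodic-p^ zero    m t _   p⁰∤m = ⊥-elim (p⁰∤m (divides m (sym (*-identityʳ m))))
  T-periodic-p^ (suc k) m t 1≤m pᵏ∤m with p ∣? m
  ... | no p∤m = trans (cong (λ z → T X (m + z)) regroup) (T-periodic m (t * p ^ k) 1≤m off-gap)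
    where
    regroup′ : ∀ t p P → t * (p * P) ≡ t * P * p
    regroup′ = solve-∀
    regroup : t * p ^ suc k ≡ t * p ^ k * period
    regroup = trans (regroup′ t p (p ^ k)) (cong (t * p ^ k *_) (sym period≡p))
    off-gap : (m ∸ 1) % period ≢ gapIdx
    off-gap e = p∤m (last-in-block⇒∣ p m (trans (sym (m%L≡m%p (m ∸ 1))) (trans e (length-segment μ 1 q))) 1≤m)
  ... | yes p∣m with proper-cofactor 2≤p 1≤m p∣m
  ...   | j , m≡pj , 1≤j , _ = begin
    T X (m + t * p ^ suc k)            ≡⟨ cong (λ z → T X (z + t * p ^ suc k)) m≡pj ⟩
    T X (p * j + t * (p * p ^ k))      ≡⟨ cong (T X) (factor p j t (p ^ k)) ⟩
    T X (p * (j + t * p ^ k))          ≡⟨ T-p* (j + t * p ^ k) (≤-trans 1≤j (m≤m+n j _)) ⟩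
    T X (j + t * p ^ k) ⊕ d            ≡⟨ cong (_⊕ d) (T-periodic-p^ k j t 1≤j pᵏ∤j) ⟩
    T X j ⊕ d                          ≡⟨ T-p* j 1≤j ⟨
    T X (p * j)                        ≡⟨ cong (T X) m≡pj ⟨
    T X m                              ∎
    where
    open ≡-Reasoning
    factor : ∀ p j t P → p * j + t * (p * P) ≡ p * (j + t * P)
    factor = solve-∀
    pᵏ∤j : ¬ p ^ k ∣ j
    pᵏ∤j pᵏ∣j = pᵏ∤m (subst (p ^ suc k ∣_) (sym m≡pj) (*-monoʳ-∣ p pᵏ∣j))

  -- If q ⊙ c = 0, T X is completely additive: on units by log-*, and
  -- factors of p are peeled off by T(p·j) = T(j) ⊕ d.
  module Additive (q⊙c≡0 : q ⊙ c ≡ fzero) where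

    T-unit-* : ∀ a b → ¬ p ∣ a → ¬ p ∣ b → T X (a * b) ≡ T X a ⊕ T X b
    T-unit-* a b p∤a p∤b = begin
      T X (a * b)                   ≡⟨ T-unit (a * b) (p∤* a b p∤a p∤b) ⟩
      log (a * b) ⊙ c               ≡⟨ ⊙-mod q (log (a * b)) c q⊙c≡0 ⟩
      (log (a * b) % q) ⊙ c         ≡⟨ cong (_⊙ c) (log-* a b p∤a p∤b) ⟨
      ((log a + log b) % q) ⊙ c     ≡⟨ ⊙-mod q (log a + log b) c q⊙c≡0 ⟨
      (log a + log b) ⊙ c           ≡⟨ ⊙-distrib-+ (log a) (log b) c ⟩
      (log a ⊙ c) ⊕ (log b ⊙ c)     ≡⟨ cong₂ _⊕_ (T-unit a p∤a) (T-unit b p∤b) ⟨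
      T X a ⊕ T X b                 ∎
      where open ≡-Reasoning

    Multiplicative≤ : ℕ → Set
    Multiplicative≤ N = ∀ a b → a + b ≤ N → 1 ≤ a → 1 ≤ b → T X (a * b) ≡ T X a ⊕ T X b

    peel-left : ∀ N → Multiplicative≤ N → ∀ a b → a + b ≤ suc N → 1 ≤ a → 1 ≤ b → p ∣ a → T X (a * b) ≡ T X a ⊕ T X b
    peel-left N ih a b ab≤ 1≤a 1≤b p∣a with proper-cofactor 2≤p 1≤a p∣a
    ... | a′ , a≡pa′ , 1≤a′ , a′<a = begin
      T X (a * b)             ≡⟨ cong (λ z → T X (z * b)) a≡pa′ ⟩
      T X (p * a′ * b)        ≡⟨ cong (T X) (*-assoc p a′ b) ⟩
      T X (p * (a′ * b))      ≡⟨ T-p* (a′ * b) (*-mono-≤ 1≤a′ 1≤b) ⟩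
      T X (a′ * b) ⊕ d        ≡⟨ cong (_⊕ d) (ih a′ b (≤-pred (≤-trans (+-monoˡ-< b a′<a) ab≤)) 1≤a′ 1≤b) ⟩
      (T X a′ ⊕ T X b) ⊕ d    ≡⟨ ⊕-swapʳ (T X a′) (T X b) d ⟩
      (T X a′ ⊕ d) ⊕ T X b    ≡⟨ cong (_⊕ T X b) (trans (cong (T X) a≡pa′) (T-p* a′ 1≤a′)) ⟨
      T X a ⊕ T X b           ∎
      where open ≡-Reasoning

    peel-right : ∀ N → Multiplicative≤ N → ∀ a b → a + b ≤ suc N → 1 ≤ a → 1 ≤ b → p ∣ b → T X (a * b) ≡ T X a ⊕ T X b
    peel-right N ih a b ab≤ 1≤a 1≤b p∣b with proper-cofactor 2≤p 1≤b p∣b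
    ... | b′ , b≡pb′ , 1≤b′ , b′<b = begin
      T X (a * b)             ≡⟨ cong (λ z → T X (a * z)) b≡pb′ ⟩
      T X (a * (p * b′))      ≡⟨ cong (T X) (*-comm-middle a p b′) ⟩
      T X (p * (a * b′))      ≡⟨ T-p* (a * b′) (*-mono-≤ 1≤a 1≤b′) ⟩
      T X (a * b′) ⊕ d        ≡⟨ cong (_⊕ d) (ih a b′ (≤-pred (≤-trans (+-monoʳ-< a b′<b) ab≤)) 1≤a 1≤b′) ⟩
      (T X a ⊕ T X b′) ⊕ d    ≡⟨ ⊕-assoc (T X a) (T X b′) d ⟩
      T X a ⊕ (T X b′ ⊕ d)    ≡⟨ cong (T X a ⊕_) (trans (cong (T X) b≡pb′) (T-p* b′ 1≤b′)) ⟨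
      T X a ⊕ T X b           ∎
      where
      open ≡-Reasoning
      *-comm-middle : ∀ a p b → a * (p * b) ≡ p * (a * b)
      *-comm-middle = solve-∀

    multiplicative : ∀ N → Multiplicative≤ N
    multiplicative zero    a b ab≤ 1≤a 1≤b = ⊥-elim (<⇒≱ (≤-trans 1≤a (m≤m+n a b)) ab≤)
    multiplicative (suc N) a b ab≤ 1≤a 1≤b with p ∣? a | p ∣? b
    ... | yes p∣a | _       = peel-left  N (multiplicative N) a b ab≤ 1≤a 1≤b p∣a
    ... | no  _   | yes p∣b = peel-right N (multiplicative N) a b ab≤ 1≤a 1≤b p∣b
    ... | no  p∤a | no  p∤b = T-unit-* a b p∤a p∤b

    T-additive : CompletelyAdditive (T X)
    T-additive = T-one , λ a b 1≤a 1≤b → multiplicative (a + b) a b ≤-refl 1≤a 1≤b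

module _ {n : ℕ} where

  LetterEq-refl : ∀ {S} (x : Letter n) → LetterEq S x x
  LetterEq-refl (inj₁ _) = sym≡
  LetterEq-refl (inj₂ _) = gap≡ (λ _ _ → refl)

  LetterEq-letter : ∀ {S} {x} {a : Sym n} → LetterEq S x (inj₁ a) → x ≡ inj₁ a
  LetterEq-letter sym≡ = refl

  ≈-numGaps : ∀ {S} {xs ys : List (Letter n)} → Pointwise (LetterEq S) xs ys → numGapsL xs ≡ numGapsL ys
  ≈-numGaps []             = refl
  ≈-numGaps (sym≡ ∷ r)    = ≈-numGaps r
  ≈-numGaps (gap≡ _ ∷ r)  = cong suc (≈-numGaps r)

  one-gap-split : ∀ (xs : List (Letter n)) → numGapsL xs ≡ 1 →
                  ∃[ ws ] ∃[ f ] ∃[ vs ] (xs ≡ ws ++ inj₂ f ∷ vs × numGapsL ws ≡ 0 × numGapsL vs ≡ 0)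
  one-gap-split (inj₁ a ∷ xs) e with one-gap-split xs e
  ... | ws , f , vs , xs≡ , gf-ws , gf-vs = inj₁ a ∷ ws , f , vs , cong (inj₁ a ∷_) xs≡ , gf-ws , gf-vs
  one-gap-split (inj₂ f ∷ xs) e = [] , f , xs , refl , refl , suc-injective e

  nonempty-prefix : ∀ (P : Pattern n) → FirstInΣ P → ∀ ws f vs → toList P ≡ ws ++ inj₂ f ∷ vs → 1 ≤ List.length ws
  nonempty-prefix (x ∷ xs) (a , x≡a) [] f vs e with trans (sym x≡a) (cong (λ { [] → x ; (y ∷ _) → y }) e)
  ... | ()
  nonempty-prefix P _ (w ∷ ws) f vs e = s≤s z≤n

  ≈-segment-gap : ∀ {S} t s N h (xs : List (Letter n)) → Pointwise (LetterEq S) xs (segment t s N ++ inj₂ h ∷ []) →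
                  ∃[ f ] (xs ≡ segment t s N ++ inj₂ f ∷ [] × (∀ x → S x → f x ≡ h x))
  ≈-segment-gap t s zero    h (inj₂ f ∷ [])  (gap≡ f≗h ∷ []) = f , refl , f≗h
  ≈-segment-gap t s (suc N) h (inj₁ a ∷ xs) (sym≡ ∷ r) with ≈-segment-gap t (suc s) N h xs r
  ... | f , xs≡ , f≗h = f , cong (inj₁ a ∷_) xs≡ , f≗h

  segment-gap-≈ : ∀ {S} (t u : ℕ → Sym n) s N f h → (∀ i → i < N → t (s + i) ≡ u (s + i)) → (∀ x → S x → f x ≡ h x) →
                  Pointwise (LetterEq S) (segment t s N ++ inj₂ f ∷ []) (segment u s N ++ inj₂ h ∷ [])
  segment-gap-≈ t u s zero    f h _   f≗h = gap≡ f≗h ∷ []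
  segment-gap-≈ {S} t u s (suc N) f h t≗u f≗h =
    subst (λ z → LetterEq S (inj₁ (t s)) (inj₁ z)) t≡u sym≡
      ∷ segment-gap-≈ t u (suc s) N f h (λ i i< → trans (cong t (sym (+-suc s i))) (trans (t≗u (suc i) (s≤s i<)) (cong u (+-suc s i)))) f≗h
    where
    t≡u : t s ≡ u s
    t≡u = trans (cong t (sym (+-identityʳ s))) (trans (t≗u 0 (s≤s z≤n)) (cong u (+-identityʳ s)))

-- The patterns 0^j ? 0^l: these are exactly the one-gap patterns with T ≡ 0.
module _ {n : ℕ} where

  numGaps-zeros : ∀ k → numGapsL (replicate k (inj₁ (fzero {n}))) ≡ 0
  numGaps-zeros zero    = refl
  numGaps-zeros (suc k) = numGaps-zeros k

  module VanishingOneGap (P : Pattern n) (first : FirstInΣ P) (ws : List (Letter n)) (f : Sym n → Sym n)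
                         (vs : List (Letter n)) (shape : toList P ≡ ws ++ inj₂ f ∷ vs)
                         (ws-gapFree : numGapsL ws ≡ 0) (vs-gapFree : numGapsL vs ≡ 0)
                         (vanishes : ∀ m → 1 ≤ m → T P m ≡ fzero) where
    open OneGap P first ws f vs shape ws-gapFree vs-gapFree

    below-period : ∀ i → i ≤ gapIdx + tailLen → i < period
    below-period i i≤ = ≤-trans (s≤s i≤) (≤-reflexive (trans (sym (+-suc gapIdx tailLen)) (sym period≡)))

    -- the letter at an index i ≠ gapIdx of P is T(i+1) = 0
    zero-at : ∀ i → i ≤ gapIdx + tailLen → i ≢ gapIdx → letterOr0 (letterAt xs i) ≡ fzero
    zero-at i i≤ i≢ = trans (cong (λ z → letterOr0 (letterAt xs z)) (sym i%L≡i))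
                        (trans (sym (T-offGap (suc i) (s≤s z≤n) (λ e → i≢ (trans (sym i%L≡i) e)))) (vanishes (suc i) (s≤s z≤n)))
      where
      i%L≡i : i % period ≡ i
      i%L≡i = m<n⇒m%n≡m (below-period i i≤)

    ws≡zeros : ws ≡ replicate gapIdx (inj₁ fzero)
    ws≡zeros = trans (gapFree≡segment ws (λ _ → fzero) 1 ws-gapFree zeros) (segment-const fzero 1 gapIdx)
      where
      zeros : ∀ i → i < gapIdx → letterOr0 (letterAt ws i) ≡ fzero
      zeros i i< = trans (cong letterOr0 (sym (trans (cong (λ z → letterAt z i) shape) (letterAt-++ˡ ws _ i i<))))
                         (zero-at i (≤-trans (<⇒≤ i<) (m≤m+n gapIdx tailLen)) (<⇒≢ i<))

    vs≡zeros : vs ≡ replicate tailLen (inj₁ fzero)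
    vs≡zeros = trans (gapFree≡segment vs (λ _ → fzero) 1 vs-gapFree zeros) (segment-const fzero 1 tailLen)
      where
      zeros : ∀ i → i < tailLen → letterOr0 (letterAt vs i) ≡ fzero
      zeros i i< = trans (cong letterOr0 (sym (trans (cong (λ z → letterAt z (gapIdx + suc i)) shape) (letterAt-++ʳ ws (inj₂ f ∷ vs) (suc i)))))
                         (zero-at (gapIdx + suc i) (+-monoʳ-≤ gapIdx i<) (λ e → <⇒≢ (m<m+n gapIdx (s≤s z≤n)) (sym e)))

    f0≡0 : f fzero ≡ fzero
    f0≡0 = trans (cong f (sym (vanishes 1 (s≤s z≤n)))) (trans (sym (T-atGap 0)) (vanishes (suc gapIdx) (s≤s z≤n)))

    ≈zeroGapZero : P ≈ₚ zeroGapZero gapIdx tailLen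
    ≈zeroGapZero = subst (λ z → Pointwise (LetterEq (OccursIn P)) z (toList (zeroGapZero gapIdx tailLen))) (sym shape′)
                         (with-prefix gapIdx (nonempty-prefix P first ws f vs shape))
      where
      shape′ : toList P ≡ replicate gapIdx (inj₁ fzero) ++ inj₂ f ∷ replicate tailLen (inj₁ fzero)
      shape′ = trans shape (cong₂ (λ a b → a ++ inj₂ f ∷ b) ws≡zeros vs≡zeros)
      -- only 0 occurs in T(P), and f fixes it
      f≗id : ∀ x → OccursIn P x → f x ≡ id x
      f≗id x (m , 1≤m , Tm≡x) = trans (cong f x≡0) (trans f0≡0 (sym x≡0))
        where
        x≡0 : x ≡ fzero
        x≡0 = trans (sym Tm≡x) (vanishes m 1≤m)
      with-prefix : ∀ j → 1 ≤ j → Pointwise (LetterEq (OccursIn P)) (replicate j (inj₁ fzero) ++ inj₂ f ∷ replicate tailLen (inj₁ fzero))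
                                                                    (toList (zeroGapZero j tailLen))
      with-prefix (suc j) _ = sym≡ ∷ Pointwise.++⁺ (Pointwise.refl (LetterEq-refl _)) (gap≡ f≗id ∷ Pointwise.refl (LetterEq-refl _))

  -- Conversely every P ≈ 0^j ? 0^l has T(P) ≡ 0: all its letters are 0 and
  -- its gap fixes 0, which occurs in T(P) at position 1.
  FixesZero : Letter n → Set
  FixesZero (inj₁ a) = a ≡ fzero
  FixesZero (inj₂ f) = f fzero ≡ fzero

  FixesZero-≈ : ∀ {S} → S fzero → ∀ (xs ys : List (Letter n)) → Pointwise (LetterEq S) xs ys →
                (∀ i → FixesZero (letterAt ys i)) → ∀ i → FixesZero (letterAt xs i)
  FixesZero-≈ S0 []       []       []             fz i       = refl
  FixesZero-≈ S0 (x ∷ xs) (y ∷ ys) (sym≡ ∷ r)     fz zero    = fz zero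
  FixesZero-≈ S0 (x ∷ xs) (y ∷ ys) (gap≡ f≗g ∷ r) fz zero    = trans (f≗g fzero S0) (fz zero)
  FixesZero-≈ S0 (x ∷ xs) (y ∷ ys) (_ ∷ r)        fz (suc i) = FixesZero-≈ S0 xs ys r (λ i → fz (suc i)) i

  FixesZero-zeroGapZero : ∀ j l i → FixesZero (letterAt (toList (zeroGapZero {n} (suc j) l)) i)
  FixesZero-zeroGapZero j l zero    = refl
  FixesZero-zeroGapZero j l (suc i) = middle j i
    where
    zeros : ∀ k i → FixesZero (letterAt (replicate k (inj₁ (fzero {n}))) i)
    zeros zero    i       = refl
    zeros (suc k) zero    = refl
    zeros (suc k) (suc i) = zeros k i
    middle : ∀ j i → FixesZero (letterAt (replicate j (inj₁ (fzero {n})) ++ gap? ∷ replicate l (inj₁ fzero)) i)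
    middle zero    zero    = refl
    middle zero    (suc i) = zeros l i
    middle (suc j) zero    = refl
    middle (suc j) (suc i) = middle j i

  ≈zeroGapZero⇒vanishing : ∀ (P : Pattern n) j l → 1 ≤ j → P ≈ₚ zeroGapZero j l →
                           FirstInΣ P × numGaps P ≡ 1 × CompletelyAdditive (T P)
  ≈zeroGapZero⇒vanishing P@(x ∷ xs) (suc j) l _ P≈@(x≈0 ∷ _) = firstP , one-gap , T-one , T-*
    where
    firstP : FirstInΣ P
    firstP = fzero , LetterEq-letter x≈0
    one-gap : numGaps P ≡ 1
    one-gap = trans (≈-numGaps P≈) (trans (numGapsL-++ (replicate j (inj₁ fzero)) (gap? ∷ replicate l (inj₁ fzero)))
                (cong₂ (λ a b → a + suc b) (numGaps-zeros j) (numGaps-zeros l)))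
    open Toeplitz P firstP
    T-one : T P 1 ≡ fzero
    T-one = T-letter 1 fzero (s≤s z≤n) (LetterEq-letter x≈0)
    fixes-zero : ∀ i → FixesZero (letterAt (toList P) i)
    fixes-zero = FixesZero-≈ (1 , s≤s z≤n , T-one) (toList P) _ P≈ (FixesZero-zeroGapZero j l)
    vanishes : ∀ m → 1 ≤ m → T P m ≡ fzero
    vanishes = <-rec (λ m → 1 ≤ m → T P m ≡ fzero) step
      where
      step : ∀ m → (∀ {k} → k < m → 1 ≤ k → T P k ≡ fzero) → 1 ≤ m → T P m ≡ fzero
      step (suc m′) earlier 1≤m = by-letter (posω P (suc m′)) refl
        where
        fz : ∀ y → posω P (suc m′) ≡ y → FixesZero y
        fz y e = subst FixesZero (trans (sym (posω≡letterAt P (suc m′))) e) (fixes-zero (m′ % len P))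
        by-letter : ∀ y → posω P (suc m′) ≡ y → T P (suc m′) ≡ fzero
        by-letter (inj₁ a) e = trans (T-letter (suc m′) a 1≤m e) (fz (inj₁ a) e)
        by-letter (inj₂ f) e = trans (T-gap (suc m′) f 1≤m e)
          (trans (cong f (earlier (s≤s (gapsUpTo-bound m′)) (gapsUpTo-atGap m′ f e))) (fz (inj₂ f) e))
    T-* : ∀ a b → 1 ≤ a → 1 ≤ b → T P (a * b) ≡ T P a ⊕ T P b
    T-* a b 1≤a 1≤b = trans (vanishes (a * b) (*-mono-≤ 1≤a 1≤b))
                            (sym (trans (cong₂ _⊕_ (vanishes a 1≤a) (vanishes b 1≤b)) (⊕-identityˡ fzero)))

-- Every P ≈ ((λ_{p,g}·c) ρ_d)^(k) with k ≥ 1 and ξ(p-1, K) ∣ c is in 𝔓: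
-- P = T(X)(1) … T(X)(p^k - 1) f with f = x ↦ x ⊕ k·d on the letters of
-- T(P), and T(P) = T(X), which is completely additive.
module LambdaPowerIn𝔓 {n : ℕ} (q : ℕ) (1≤q : 1 ≤ q) (pr : Prime (suc q)) (g : ℕ) (prim : IsPrimitiveRoot (suc q) g)
                      (c d : Sym n) (k : ℕ) (1≤k : 1 ≤ k) (q⊙c≡0 : q ⊙ c ≡ fzero)
                      (P : Pattern n) (P≈Xᵏ : P ≈ₚ ppow (lamPattern (suc q) g c d) k) where
  open LambdaPattern q 1≤q pr g prim c d

  pᵏ N : ℕ
  pᵏ = p ^ k
  N  = pᵏ ∸ 1

  2≤pᵏ : 2 ≤ pᵏ
  2≤pᵏ = 2≤^ k (s≤s 1≤q) 1≤k

  N+1≡pᵏ : suc N ≡ pᵏ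
  N+1≡pᵏ = trans (+-comm 1 N) (m∸n+n≡m (≤-trans (s≤s z≤n) 2≤pᵏ))

  h : Sym n → Sym n
  h = proj₁ (composition-power k)

  h≗ : ∀ x → h x ≡ rotation-power k x
  h≗ = proj₁ (proj₂ (composition-power k))

  decomposition : ∃[ f ] (toList P ≡ segment (T X) 1 N ++ inj₂ f ∷ [] × (∀ x → OccursIn P x → f x ≡ h x))
  decomposition = ≈-segment-gap (T X) 1 N h (toList P)
    (subst (Pointwise (LetterEq (OccursIn P)) (toList P)) (proj₂ (proj₂ (composition-power k))) P≈Xᵏ)

  f : Sym n → Sym n
  f = proj₁ decomposition

  shapeP : toList P ≡ segment (T X) 1 N ++ inj₂ f ∷ []
  shapeP = proj₁ (proj₂ decomposition)

  f≗h : ∀ x → OccursIn P x → f x ≡ h x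
  f≗h = proj₂ (proj₂ decomposition)

  firstP : FirstInΣ P
  firstP = first-of-segment P (T X) 1 N _ (∸-monoˡ-≤ 1 2≤pᵏ) shapeP

  one-gap : numGaps P ≡ 1
  one-gap = trans (cong numGapsL shapeP) (trans (numGapsL-++ (segment (T X) 1 N) _) (cong (_+ 1) (segment-gapFree (T X) 1 N)))

  module ShapeP = OneGap P firstP (segment (T X) 1 N) f [] shapeP (segment-gapFree (T X) 1 N) refl

  gapIdx≡N : ShapeP.gapIdx ≡ N
  gapIdx≡N = length-segment (T X) 1 N

  period≡pᵏ : ShapeP.period ≡ pᵏ
  period≡pᵏ = trans ShapeP.period≡ (trans (+-comm ShapeP.gapIdx 1) (trans (cong suc gapIdx≡N) N+1≡pᵏ))

  -- off the multiples of p^k, P reads the prefix of T(X), which is p^k-periodic there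
  agree-off : ∀ m → 1 ≤ m → ¬ pᵏ ∣ m → T P m ≡ T X m
  agree-off m 1≤m pᵏ∤m = begin
    T P m                                       ≡⟨ ShapeP.T-offGap m 1≤m off-gap ⟩
    letterOr0 (letterAt ShapeP.xs r)            ≡⟨ cong (λ z → letterOr0 (letterAt z r)) shapeP ⟩
    letterOr0 (letterAt (segment (T X) 1 N ++ inj₂ f ∷ []) r) ≡⟨ cong letterOr0 (letterAt-++ˡ (segment (T X) 1 N) _ r (subst (r <_) (sym gapIdx≡N) r<N)) ⟩
    letterOr0 (letterAt (segment (T X) 1 N) r)  ≡⟨ cong letterOr0 (letterAt-segment (T X) 1 N r r<N) ⟩
    T X (suc r)                                 ≡⟨ T-periodic-p^ k (suc r) t (s≤s z≤n) pᵏ∤r+1 ⟨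
    T X (suc r + t * pᵏ)                        ≡⟨ cong (T X) m≡ ⟨
    T X m                                       ∎
    where
    open ≡-Reasoning
    r t : ℕ
    r = (m ∸ 1) % ShapeP.period
    t = (m ∸ 1) / ShapeP.period
    last≡ : ShapeP.period ∸ 1 ≡ ShapeP.gapIdx
    last≡ = trans (cong (_∸ 1) ShapeP.period≡) (m+n∸n≡m ShapeP.gapIdx 1)
    off-gap : r ≢ ShapeP.gapIdx
    off-gap e = pᵏ∤m (subst (_∣ m) period≡pᵏ (last-in-block⇒∣ ShapeP.period m (trans e (sym last≡)) 1≤m))
    r<N : r < N
    r<N = ≤∧≢⇒< (subst (r ≤_) (trans (sym last≡) (cong (_∸ 1) period≡pᵏ)) (≤-pred (subst (r <_) (trans ShapeP.period≡ (+-comm ShapeP.gapIdx 1)) (m%n<n (m ∸ 1) ShapeP.period))))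
                 (λ e → off-gap (trans e (sym gapIdx≡N)))
    m≡ : m ≡ suc r + t * pᵏ
    m≡ = trans (sym (m∸n+n≡m 1≤m)) (trans (+-comm (m ∸ 1) 1) (cong suc (trans (m≡m%n+[m/n]*n (m ∸ 1) ShapeP.period) (cong (λ z → r + t * z) period≡pᵏ))))
    pᵏ∤r+1 : ¬ pᵏ ∣ suc r
    pᵏ∤r+1 pᵏ∣ = <⇒≱ (subst (suc r <_) N+1≡pᵏ (s≤s r<N)) (∣⇒≤ pᵏ∣)

  agree : ∀ m → 1 ≤ m → T P m ≡ T X m
  agree = <-rec (λ m → 1 ≤ m → T P m ≡ T X m) step
    where
    step : ∀ m → (∀ {j} → j < m → 1 ≤ j → T P j ≡ T X j) → 1 ≤ m → T P m ≡ T X m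
    step m earlier 1≤m with pᵏ ∣? m
    ... | no pᵏ∤m = agree-off m 1≤m pᵏ∤m
    ... | yes pᵏ∣m with proper-cofactor 2≤pᵏ 1≤m pᵏ∣m
    ...   | j , m≡pᵏj , 1≤j , j<m = begin
      T P m                          ≡⟨ cong (T P) m≡gap ⟩
      T P (j′ * ShapeP.period + suc ShapeP.gapIdx) ≡⟨ ShapeP.T-atGap j′ ⟩
      f (T P (suc j′))               ≡⟨ cong (f ∘ T P) suc-j′≡j ⟩
      f (T P j)                      ≡⟨ f≗h (T P j) (j , 1≤j , refl) ⟩
      h (T P j)                      ≡⟨ h≗ (T P j) ⟩
      T P j ⊕ (k ⊙ d)                ≡⟨ cong (_⊕ (k ⊙ d)) (earlier j<m 1≤j) ⟩
      T X j ⊕ (k ⊙ d)                ≡⟨ T-p^ k j 1≤j ⟨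
      T X (pᵏ * j)                   ≡⟨ cong (T X) m≡pᵏj ⟨
      T X m                          ∎
      where
      open ≡-Reasoning
      j′ : ℕ
      j′ = j ∸ 1
      suc-j′≡j : suc j′ ≡ j
      suc-j′≡j = trans (+-comm 1 j′) (m∸n+n≡m 1≤j)
      m≡gap : m ≡ j′ * ShapeP.period + suc ShapeP.gapIdx
      m≡gap = trans m≡pᵏj (trans (*-comm pᵏ j) (trans (cong (_* pᵏ) (sym (m∸n+n≡m 1≤j))) (trans (cong ((j′ + 1) *_) (sym period≡pᵏ))
                (trans (*-distribʳ-+ ShapeP.period j′ 1) (cong (j′ * ShapeP.period +_) (trans (*-identityˡ ShapeP.period) (trans ShapeP.period≡ (+-comm ShapeP.gapIdx 1))))))))

  in𝔓 : FirstInΣ P × numGaps P ≡ 1 × CompletelyAdditive (T P)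
  in𝔓 = firstP , one-gap , T-one′ , T-*
    where
    open Additive q⊙c≡0
    T-one′ : T P 1 ≡ fzero
    T-one′ = trans (agree 1 (s≤s z≤n)) (proj₁ T-additive)
    T-* : ∀ a b → 1 ≤ a → 1 ≤ b → T P (a * b) ≡ T P a ⊕ T P b
    T-* a b 1≤a 1≤b = begin
      T P (a * b)      ≡⟨ agree (a * b) (*-mono-≤ 1≤a 1≤b) ⟩
      T X (a * b)      ≡⟨ proj₂ T-additive a b 1≤a 1≤b ⟩
      T X a ⊕ T X b    ≡⟨ cong₂ _⊕_ (agree a 1≤a) (agree b 1≤b) ⟨
      T P a ⊕ T P b    ∎
      where open ≡-Reasoning

module _ {n : ℕ} where

  -- If the gap is not the last symbol, T(P)(L·t) = T(P)(L) for L = |P|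
  -- (position L is a letter and L + (t-1)L is the same letter), so T(P) ≡ 0.
  module GapInside (P : Pattern n) (first : FirstInΣ P) (ca : CompletelyAdditive (T P))
                   (ws : List (Letter n)) (f : Sym n → Sym n) (v : Letter n) (vs : List (Letter n))
                   (shape : toList P ≡ ws ++ inj₂ f ∷ v ∷ vs) (ws-gapFree : numGapsL ws ≡ 0) (vs-gapFree : numGapsL (v ∷ vs) ≡ 0) where
    open OneGap P first ws f (v ∷ vs) shape ws-gapFree vs-gapFree

    1≤period : 1 ≤ period
    1≤period = subst (1 ≤_) (sym period≡) (≤-trans (s≤s z≤n) (m≤n+m (suc tailLen) gapIdx))

    constant-on-multiples : ∀ t → 1 ≤ t → T P (period * t) ≡ T P period
    constant-on-multiples t 1≤t = trans (cong (T P) multiple≡) (T-periodic period (t ∸ 1) 1≤period off-gap)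
      where
      multiple≡ : period * t ≡ period + (t ∸ 1) * period
      multiple≡ = trans (*-comm period t) (cong (_* period) (trans (sym (m∸n+n≡m 1≤t)) (+-comm (t ∸ 1) 1)))
      last≡ : period ∸ 1 ≡ gapIdx + tailLen
      last≡ = trans (cong (_∸ 1) period≡) (cong (_∸ 1) (+-suc gapIdx tailLen))
      last<period : ∀ L → 1 ≤ L → L ∸ 1 < L
      last<period (suc L) _ = n<1+n L
      off-gap : (period ∸ 1) % period ≢ gapIdx
      off-gap e = <⇒≢ (m<m+n gapIdx (s≤s z≤n))
        (sym (trans (sym last≡) (trans (sym (m<n⇒m%n≡m (last<period period 1≤period))) e)))

    vanishes : ∀ m → 1 ≤ m → T P m ≡ fzero
    vanishes = CompletelyAdditiveSeq.vanishes-of-constant-on-multiples (T P) ca period 1≤period constant-on-multiples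

    ≈zeroPattern : ∃[ j ] ∃[ l ] (1 ≤ j × P ≈ₚ zeroGapZero j l)
    ≈zeroPattern = gapIdx , tailLen , nonempty-prefix P first ws f (v ∷ vs) shape ,
                   VanishingOneGap.≈zeroGapZero P first ws f (v ∷ vs) shape ws-gapFree vs-gapFree vanishes

  module GapAtEnd (P : Pattern n) (first : FirstInΣ P) (ca : CompletelyAdditive (T P))
                  (ws : List (Letter n)) (f : Sym n → Sym n)
                  (shape : toList P ≡ ws ++ inj₂ f ∷ []) (ws-gapFree : numGapsL ws ≡ 0) where
    open OneGap P first ws f [] shape ws-gapFree refl
    open CompletelyAdditiveSeq (T P) ca

    1≤gapIdx : 1 ≤ gapIdx
    1≤gapIdx = nonempty-prefix P first ws f [] shape

    gapIdx≡period∸1 : gapIdx ≡ period ∸ 1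
    gapIdx≡period∸1 = sym (trans (cong (_∸ 1) period≡) (m+n∸n≡m gapIdx 1))

    2≤period : 2 ≤ period
    2≤period = ≤-trans (s≤s 1≤gapIdx) (≤-reflexive (trans (+-comm 1 gapIdx) (sym period≡)))

    periodic : PeriodicOffMultiples period
    periodic m t 1≤m L∤m = T-periodic m t 1≤m (λ e → L∤m (last-in-block⇒∣ period m (trans e gapIdx≡period∸1) 1≤m))

    ≈zeroPattern : ∀ A B → 2 ≤ A → 2 ≤ B → period ≡ A * B → Coprime A B → ∃[ j ] ∃[ l ] (1 ≤ j × P ≈ₚ zeroGapZero j l)
    ≈zeroPattern A B 2≤A 2≤B L≡AB A⊥B = gapIdx , 0 , 1≤gapIdx ,
      VanishingOneGap.≈zeroGapZero P first ws f [] shape ws-gapFree refl (CoprimeSplit.vanishes periodic A B 2≤A 2≤B L≡AB A⊥B)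

    module PrimePowerLength (q : ℕ) (1≤q : 1 ≤ q) (pr : Prime (suc q)) (g : ℕ) (prim : IsPrimitiveRoot (suc q) g)
                            (a : ℕ) (L≡pᵃ⁺¹ : period ≡ suc q ^ suc a) where
      open PrimePowerPeriod q 1≤q pr g prim a (subst PeriodicOffMultiples L≡pᵃ⁺¹ periodic) using (τ-unit; q⊙τg≡0)

      c d : Sym n
      c = T P g
      d = T P (suc q)

      module Λ = LambdaPattern q 1≤q pr g prim c d
      open Λ using (p; X)

      q⊙c≡0 : q ⊙ c ≡ fzero
      q⊙c≡0 = q⊙τg≡0

      agree : ∀ m → 1 ≤ m → T P m ≡ T X m
      agree = <-rec (λ m → 1 ≤ m → T P m ≡ T X m) step
        where
        step : ∀ m → (∀ {j} → j < m → 1 ≤ j → T P j ≡ T X j) → 1 ≤ m → T P m ≡ T X m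
        step m earlier 1≤m with p ∣? m
        ... | no  p∤m = trans (τ-unit m p∤m) (sym (Λ.T-unit m p∤m))
        ... | yes p∣m with proper-cofactor Λ.2≤p 1≤m p∣m
        ...   | j , m≡pj , 1≤j , j<m = begin
          T P m          ≡⟨ cong (T P) m≡pj ⟩
          T P (p * j)    ≡⟨ τ-* p j (s≤s z≤n) 1≤j ⟩
          d ⊕ T P j      ≡⟨ cong (d ⊕_) (earlier j<m 1≤j) ⟩
          d ⊕ T X j      ≡⟨ ⊕-comm d (T X j) ⟩
          T X j ⊕ d      ≡⟨ Λ.T-p* j 1≤j ⟨
          T X (p * j)    ≡⟨ cong (T X) m≡pj ⟨
          T X m          ∎
          where open ≡-Reasoning

      τ-p^ : ∀ k → T P (p ^ k) ≡ k ⊙ d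
      τ-p^ zero    = τ-one
      τ-p^ (suc k) = trans (τ-* p (p ^ k) (s≤s z≤n) (m^n>0 p k)) (cong (d ⊕_) (τ-p^ k))

      N : ℕ
      N = p ^ suc a ∸ 1

      h : Sym n → Sym n
      h = proj₁ (Λ.composition-power (suc a))

      -- on T(P), the gap of P acts as the rotation by (a+1)·d = T(P)(p^(a+1))
      f≗h : ∀ x → OccursIn P x → f x ≡ h x
      f≗h x (suc m , _ , Tm≡x) = begin
        f x                           ≡⟨ cong f Tm≡x ⟨
        f (T P (suc m))               ≡⟨ T-atGap m ⟨
        T P (m * period + suc gapIdx) ≡⟨ cong (λ z → T P (m * period + z)) (trans (+-comm 1 gapIdx) (sym period≡)) ⟩
        T P (m * period + period)     ≡⟨ cong (T P) (trans (+-comm (m * period) period) (*-comm (suc m) period)) ⟩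
        T P (period * suc m)          ≡⟨ τ-* period (suc m) (≤-trans (s≤s z≤n) 2≤period) (s≤s z≤n) ⟩
        T P period ⊕ T P (suc m)      ≡⟨ cong₂ _⊕_ (trans (cong (T P) L≡pᵃ⁺¹) (τ-p^ (suc a))) Tm≡x ⟩
        (suc a ⊙ d) ⊕ x               ≡⟨ ⊕-comm _ x ⟩
        x ⊕ (suc a ⊙ d)               ≡⟨ proj₁ (proj₂ (Λ.composition-power (suc a))) x ⟨
        h x                           ∎
        where open ≡-Reasoning

      ws≡ : ws ≡ segment (T P) 1 N
      ws≡ = trans (gapFree≡segment ws (T P) 1 ws-gapFree letters) (cong (segment (T P) 1) (trans gapIdx≡period∸1 (cong (_∸ 1) L≡pᵃ⁺¹)))
        where
        letters : ∀ i → i < gapIdx → letterOr0 (letterAt ws i) ≡ T P (1 + i)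
        letters i i< = sym (trans (T-offGap (suc i) (s≤s z≤n) off-gap)
          (cong letterOr0 (trans (cong (letterAt xs) i%L≡i) (trans (cong (λ z → letterAt z i) shape) (letterAt-++ˡ ws _ i i<)))))
          where
          i%L≡i : i % period ≡ i
          i%L≡i = m<n⇒m%n≡m (≤-trans i< (<⇒≤ gapIdx<period))
          off-gap : i % period ≢ gapIdx
          off-gap e = <⇒≢ i< (trans (sym i%L≡i) e)

      ≈λ-power : P ≈ₚ ppow X (suc a)
      ≈λ-power = subst₂ (Pointwise (LetterEq (OccursIn P))) (sym shape′) (sym (proj₂ (proj₂ (Λ.composition-power (suc a)))))
                   (segment-gap-≈ (T P) (T X) 1 N f h (λ i _ → agree (1 + i) (s≤s z≤n)) f≗h)
        where
        shape′ : toList P ≡ segment (T P) 1 N ++ inj₂ f ∷ []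
        shape′ = trans shape (cong (_++ inj₂ f ∷ []) ws≡)

module _ {n : ℕ} (g : ℕ → ℕ) (isRoot : ∀ p → Prime p → IsPrimitiveRoot p (g p)) where

  no-prime-zero : ¬ Prime 0
  no-prime-zero pr = <⇒≱ (prime≥2 pr) z≤n

  𝔓⊆RHS : ∀ (P : Pattern n) → InFrakP P → InRHS g P
  𝔓⊆RHS P (_ , first , one-gap , ca) with one-gap-split (toList P) one-gap
  ... | ws , f , v ∷ vs , shape , ws-gf , vs-gf = inj₂ (GapInside.≈zeroPattern P first ca ws f v vs shape ws-gf vs-gf)
  ... | ws , f , [] , shape , ws-gf , _ with primePower⊎coprimeSplit (len P) (GapAtEnd.2≤period P first ca ws f shape ws-gf)
  ...   | inj₂ (A , B , 2≤A , 2≤B , L≡AB , A⊥B) = inj₂ (GapAtEnd.≈zeroPattern P first ca ws f shape ws-gf A B 2≤A 2≤B L≡AB A⊥B)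
  ...   | inj₁ (zero  , a , pr , _)   = ⊥-elim (no-prime-zero pr)
  ...   | inj₁ (suc q , a , pr , L≡) =
          inj₁ (suc q , suc a , c , d , pr , s≤s z≤n , DividesΣ-characterisation.q⊙≡0⇒ξ-divides q c q⊙c≡0 , ≈λ-power)
    where open GapAtEnd.PrimePowerLength P first ca ws f shape ws-gf q (≤-pred (prime≥2 pr)) pr (g (suc q)) (isRoot (suc q) pr) a L≡

  RHS⊆𝔓 : ∀ (P : Pattern n) → InRHS g P → FirstInΣ P × numGaps P ≡ 1 × CompletelyAdditive (T P)
  RHS⊆𝔓 P (inj₂ (j , l , 1≤j , P≈)) = ≈zeroGapZero⇒vanishing P j l 1≤j P≈
  RHS⊆𝔓 P (inj₁ (zero  , _ , _ , _ , pr , _)) = ⊥-elim (no-prime-zero pr)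
  RHS⊆𝔓 P (inj₁ (suc q , k , c , d , pr , 1≤k , ξ∣c , P≈)) =
    LambdaPowerIn𝔓.in𝔓 q (≤-pred (prime≥2 pr)) pr (g (suc q)) (isRoot (suc q) pr) c d k 1≤k
                         (DividesΣ-characterisation.ξ-divides⇒q⊙≡0 q c ξ∣c) P P≈

mainTheorem1 : (n : ℕ) (g : ℕ → ℕ) →
    (∀ p → Prime p → IsPrimitiveRoot p (g p)) → g 2 ≡ 1 →
    (P : Pattern n) → IsSigmaPattern P →
    (InFrakP P ⇔ InRHS g P)
mainTheorem1 n g isRoot _ P sigma = mk⇔ (𝔓⊆RHS g isRoot P) (λ inRHS → sigma , RHS⊆𝔓 g isRoot P inRHS)
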